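{- Let $S^\star\subset S$. Then $S^\star$ generates $\mathcal{J}$ (as a two-sided ideal) if and only if for every upper prime $U$ and every lower prime $D$ there exist words $U'\sim U$ and $D'\sim D$ such that $U'D'-D'U'\in S^\star$ or $D'U'-U'D'\in S^\star$.
   Context: Let $\mathcal{A}$ be the free associative $\mathbb{C}$-algebra on two generators $L$ and $R$ (letters). A word is a finite product of letters (possibly empty); words form a basis of $\mathcal{A}$. A word is balanced if $L$ and $R$ occur in it equally many times. Let $S=\{FG-GF\colon F,G \text{ nonempty balanced words}\}$, let $\mathcal{J}$ be the two-sided ideal of $\mathcal{A}$ generated by $S$, and for words $X,Y$ write $X\sim Y$ if $X-Y\in\mathcal{J}$. A word is prime if it is nonempty, balanced, and not a product of two nonempty balanced words. For a word $W=a_1\cdots a_n$ and $0\le k\le n$, $e_k(W)=\sum_{i=1}^k\overline{a_i}$ with $\overline{R}=1$, $\overline{L}=-1$. A prime $P$ of length $l(P)$ is an upper prime if $e_k(P)>0$ for $1\le k\le l(P)-1$, and a lower prime if $e_k(P)<0$ for $1\le k\le l(P)-1$. -}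

module Defs where

open import Level using (Level; _⊔_; 0ℓ)
open import Data.List using (List; []; _∷_; _++_; map; length)
open import Data.List.Properties using (≡-dec)
open import Data.Nat using (ℕ; zero; suc; _≤_; _<_)
open import Data.Integer using (ℤ; +_; -[1+_]) renaming (_+_ to _+ℤ_)
open import Data.Product using (_×_; _,_; ∃-syntax)
open import Data.Sum using (_⊎_)
open import Relation.Nullary using (¬_; yes; no)
open import Relation.Binary.PropositionalEquality using (_≡_; _≢_; refl)
open import Relation.Binary.Definitions using (DecidableEquality)
open import Algebra.Apartness.Bundles using (HeytingField)

data Letter : Set where
  L R : Letter

_≟L_ : DecidableEquality Letter
L ≟L L = yes refl
L ≟L R = no (λ ())
R ≟L L = no (λ ())
R ≟L R = yes refl

Word : Set
Word = List Letter

_≟W_ : DecidableEquality Word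
_≟W_ = ≡-dec _≟L_

count : Letter → Word → ℕ
count x [] = zero
count x (y ∷ w) with x ≟L y
... | yes _ = suc (count x w)
... | no  _ = count x w

NonEmpty : Word → Set
NonEmpty w = w ≢ []

Balanced : Word → Set
Balanced w = count L w ≡ count R w

IsPrime : Word → Set
IsPrime P = NonEmpty P × Balanced P ×
  ¬ (∃[ A ] ∃[ B ] (NonEmpty A × Balanced A × NonEmpty B × Balanced B × P ≡ A ++ B))

val : Letter → ℤ
val R = + 1
val L = -[1+ 0 ]

e : ℕ → Word → ℤ
e zero    w       = + 0
e (suc k) []      = + 0
e (suc k) (a ∷ w) = val a +ℤ e k w

UpperPrime : Word → Set
UpperPrime P = IsPrime P × (∀ k → 1 ≤ k → k < length P → + 0 Data.Integer.< e k P)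

LowerPrime : Word → Set
LowerPrime P = IsPrime P × (∀ k → 1 ≤ k → k < length P → e k P Data.Integer.< + 0)

-- The free associative algebra K⟨L,R⟩ over a (Heyting) field K.
-- Elements are represented by finite formal sums (lists of
-- coefficient/word pairs); two representations are identified when
-- all their coefficients agree (_≃_).

module Alg {c ℓ₁ ℓ₂ : Level} (K : HeytingField c ℓ₁ ℓ₂) where
  open HeytingField K

  Poly : Set c
  Poly = List (Carrier × Word)

  coeff : Poly → Word → Carrier
  coeff [] w = 0#
  coeff ((k , v) ∷ p) w with v ≟W w
  ... | yes _ = k + coeff p w
  ... | no  _ = coeff p w

  _≃_ : Poly → Poly → Set ℓ₁
  p ≃ q = ∀ w → coeff p w ≈ coeff q w

  word : Word → Poly
  word w = (1# , w) ∷ []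

  neg : Poly → Poly
  neg = map (λ { (k , w) → (- k , w) })

  _⊖_ : Poly → Poly → Poly
  p ⊖ q = p ++ neg q

  sandwich : Carrier → Word → Poly → Word → Poly
  sandwich k a t b = map (λ { (k' , w) → (k * k' , a ++ w ++ b) }) t

  data InIdeal {p : Level} (T : Poly → Set p) : Poly → Set (c ⊔ ℓ₁ ⊔ p) where
    none : ∀ {q} → q ≃ [] → InIdeal T q
    add  : ∀ {q r} (k : Carrier) (a : Word) (t : Poly) (b : Word) →
           T t → InIdeal T r → q ≃ (sandwich k a t b ++ r) → InIdeal T q

  commutator : Word → Word → Poly
  commutator F G = word (F ++ G) ⊖ word (G ++ F)

  InS : Poly → Set ℓ₁
  InS q = ∃[ F ] ∃[ G ] (NonEmpty F × Balanced F × NonEmpty G × Balanced G ×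
                          q ≃ commutator F G)

  J : Poly → Set (c ⊔ ℓ₁)
  J = InIdeal InS

  _∼_ : Word → Word → Set (c ⊔ ℓ₁)
  X ∼ Y = J (word X ⊖ word Y)

  _∈ₚ_ : {p : Level} → Poly → (Poly → Set p) → Set (c ⊔ ℓ₁ ⊔ p)
  x ∈ₚ T = ∃[ q ] (T q × q ≃ x)

  SubsetOfS : {p : Level} → (Poly → Set p) → Set (c ⊔ ℓ₁ ⊔ p)
  SubsetOfS T = ∀ q → T q → InS q

  GeneratesJ : {p : Level} → (Poly → Set p) → Set (c ⊔ ℓ₁ ⊔ p)
  GeneratesJ T = ∀ q → (InIdeal T q → J q) × (J q → InIdeal T q)

-- If: by induction on |FG|, every commutator FG − GF of balanced words lies in the
-- ideal I generated by S⋆. When F or G splits into two balanced factors, or F and G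
-- are primes of the same sign (hence of the form rXl and rYl), FG − GF is a
-- combination of shorter commutators. For an upper prime U and a lower prime D the
-- hypothesis gives U′D′ − D′U′ ∈ S⋆ with U′ ∼ U and D′ ∼ D, and these congruences hold
-- modulo I already, because the degree-|U| component of a J-derivation of U′ − U only
-- uses commutators of degree |U|.
--
-- Only if: fix an I-derivation of UD − DU. A swap a·F·G·b ↦ a·G·F·b that keeps the
-- first letter preserves "W = U′D′ with U′ ∼ U upper and D′ ∼ D lower", so every word
-- in the class of UD under such swaps of the derivation starts with R. The indicator f
-- of this class has f(UD) − f(DU) = 1, hence does not vanish on some term of the
-- derivation; that term is a swap changing the first letter, which can only be
-- U′D′ ↦ D′U′ itself, and its commutator lies in S⋆.

module Submission where

open import Defs
open import Level using (Level)
open import Data.Product using (_×_; ∃-syntax)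
open import Data.Sum using (_⊎_)
open import Function.Bundles using (_⇔_)
open import Algebra.Apartness.Bundles using (HeytingField)
open import Algebra.Apartness.Bundles using (HeytingCommutativeRing)

open import Level using (_⊔_)
open import Function.Bundles using (mk⇔)
open import Data.Product using (_,_; proj₁; proj₂)
open import Data.Sum as Sum using (inj₁; inj₂; [_,_]′)
open import Data.Empty using (⊥; ⊥-elim)
open import Data.Nat as ℕ using (ℕ; zero; suc; z≤n; s≤s)
import Data.Nat.Properties as ℕₚ
open import Data.Integer using (0ℤ)
open import Data.Maybe using (just)
import Data.Maybe.Properties as Maybe
open import Data.List using (List; []; _∷_; _++_; length; take; drop; initLast; _∷ʳ′_; head; foldr)
open import Data.List.Properties
  using (++-monoid; ++-assoc; ++-identityʳ; ∷-injective; ++-conicalˡ; ++-conicalʳ; length-++; length-++-comm; take++drop≡id)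
open import Data.List.Relation.Unary.All as All using (All; []; _∷_)
import Data.List.Relation.Unary.All.Properties as All
open import Algebra.Bundles using (Monoid; CommutativeRing)
open import Relation.Nullary using (¬_; yes; no; Dec)
open import Relation.Binary.Definitions using (DecidableEquality)
open import Relation.Binary.Bundles using (Setoid)
import Relation.Binary.Reasoning.Setoid
open import Relation.Binary.PropositionalEquality
  using (_≡_; _≢_; refl; sym; trans; cong; subst; subst₂; module ≡-Reasoning)
open import Tactic.MonoidSolver using (solve)

Words : Monoid _ _
Words = ++-monoid Letter

++-equidivisible : ∀ {A : Set} (p s x y : List A) → p ++ s ≡ x ++ y →
  (∃[ m ] x ≡ p ++ m × s ≡ m ++ y) ⊎ (∃[ m ] p ≡ x ++ m × y ≡ m ++ s)
++-equidivisible []      s x       y eq = inj₁ (x , refl , eq)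
++-equidivisible (c ∷ p) s []      y eq = inj₂ (c ∷ p , refl , sym eq)
++-equidivisible (c ∷ p) s (d ∷ x) y eq with ∷-injective eq
... | refl , eq′ with ++-equidivisible p s x y eq′
...   | inj₁ (m , x≡ , s≡) = inj₁ (m , cong (c ∷_) x≡ , s≡)
...   | inj₂ (m , p≡ , y≡) = inj₂ (m , cong (c ∷_) p≡ , y≡)

empty⊎nonEmpty : ∀ w → w ≡ [] ⊎ NonEmpty w
empty⊎nonEmpty []      = inj₁ refl
empty⊎nonEmpty (_ ∷ _) = inj₂ (λ ())

++-nonEmptyˡ : ∀ {u} v → NonEmpty u → NonEmpty (u ++ v)
++-nonEmptyˡ {u} v ne eq = ne (++-conicalˡ u v eq)

++-nonEmptyʳ : ∀ u {v} → NonEmpty v → NonEmpty (u ++ v)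
++-nonEmptyʳ u {v} ne eq = ne (++-conicalʳ u v eq)

length-nonEmpty : ∀ {w} → NonEmpty w → 1 ℕ.≤ length w
length-nonEmpty {[]}    ne = ⊥-elim (ne refl)
length-nonEmpty {_ ∷ _} ne = s≤s z≤n

take-nonEmpty : ∀ k w → 1 ℕ.≤ k → NonEmpty w → NonEmpty (take k w)
take-nonEmpty (suc k) []      _ ne = ne
take-nonEmpty (suc k) (_ ∷ _) _ _  ()

drop-nonEmpty : ∀ k w → k ℕ.< length w → NonEmpty (drop k w)
drop-nonEmpty zero    (_ ∷ _) _         ()
drop-nonEmpty (suc k) (_ ∷ w) (s≤s k<) = drop-nonEmpty k w k<

length-++-<ˡ : ∀ u v → NonEmpty u → length v ℕ.< length (u ++ v)
length-++-<ˡ u v nu = subst (length v ℕ.<_) (sym (length-++ u {v})) (ℕₚ.m<n+m (length v) (length-nonEmpty nu))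

length-++-<ʳ : ∀ u v → NonEmpty v → length u ℕ.< length (u ++ v)
length-++-<ʳ u v nv = subst (length u ℕ.<_) (sym (length-++ u {v})) (ℕₚ.m<m+n (length u) (length-nonEmpty nv))

length-erase-< : ∀ a x b → NonEmpty x → length (a ++ b) ℕ.< length (a ++ x ++ b)
length-erase-< []      x b nx = length-++-<ˡ x b nx
length-erase-< (_ ∷ a) x b nx = s≤s (length-erase-< a x b nx)

length-infix-≤ : ∀ (a x b : Word) → length x ℕ.≤ length (a ++ x ++ b)
length-infix-≤ []      x b = subst (length x ℕ.≤_) (sym (length-++ x {b})) (ℕₚ.m≤m+n (length x) (length b))
length-infix-≤ (_ ∷ a) x b = ℕₚ.m≤n⇒m≤1+n (length-infix-≤ a x b)

length-infix-< : ∀ a x b → NonEmpty a → length x ℕ.< length (a ++ x ++ b)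
length-infix-< a x b na = ℕₚ.≤-<-trans (length-infix-≤ [] x b) (length-++-<ˡ a (x ++ b) na)

length-swap : ∀ (a F G b : Word) → length (a ++ F ++ G ++ b) ≡ length (a ++ G ++ F ++ b)
length-swap a F G b = begin
  length (a ++ F ++ G ++ b)                    ≡⟨ cong (λ w → length (a ++ w)) (++-assoc F G b) ⟨
  length (a ++ (F ++ G) ++ b)                  ≡⟨ length-++ a ⟩
  length a ℕ.+ length ((F ++ G) ++ b)          ≡⟨ cong (length a ℕ.+_) (length-++ (F ++ G)) ⟩
  length a ℕ.+ (length (F ++ G) ℕ.+ length b)  ≡⟨ cong (λ n → length a ℕ.+ (n ℕ.+ length b)) (length-++-comm F G) ⟩
  length a ℕ.+ (length (G ++ F) ℕ.+ length b)  ≡⟨ cong (length a ℕ.+_) (length-++ (G ++ F)) ⟨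
  length a ℕ.+ length ((G ++ F) ++ b)          ≡⟨ length-++ a ⟨
  length (a ++ (G ++ F) ++ b)                  ≡⟨ cong (λ w → length (a ++ w)) (++-assoc G F b) ⟩
  length (a ++ G ++ F ++ b)                    ∎
  where open ≡-Reasoning

module Heights where

  open import Data.Integer using (ℤ; +_; -[1+_]; +[1+_]; _+_; -_; _<_; _≤_; +<+; -<+; _≟_)
  import Data.Integer.Properties as ℤ
  open import Data.Integer.Tactic.RingSolver using (solve-∀)
  open import Algebra.Properties.AbelianGroup ℤ.+-0-abelianGroup using (identityˡ-unique; inverseˡ-unique)

  private
    x≡-y : ∀ x y → x + y ≡ 0ℤ → x ≡ - y
    x≡-y = inverseˡ-unique

  height : Word → ℤ
  height []      = 0ℤ
  height (x ∷ w) = val x + height w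

  height-++ : ∀ u v → height (u ++ v) ≡ height u + height v
  height-++ []      v = sym (ℤ.+-identityˡ (height v))
  height-++ (x ∷ u) v = trans (cong (_+_ (val x)) (height-++ u v)) (sym (ℤ.+-assoc (val x) (height u) (height v)))

  height-∷ʳ : ∀ u x → height (u ++ x ∷ []) ≡ height u + val x
  height-∷ʳ u x = trans (height-++ u (x ∷ [])) (cong (_+_ (height u)) (ℤ.+-identityʳ (val x)))

  height+#L≡#R : ∀ w → height w + + count L w ≡ + count R w
  height+#L≡#R []      = refl
  height+#L≡#R (L ∷ w) = trans (cancel (height w) (+ count L w)) (height+#L≡#R w)
    where
    cancel : ∀ a b → (- + 1 + a) + (+ 1 + b) ≡ a + b
    cancel = solve-∀
  height+#L≡#R (R ∷ w) = trans (ℤ.+-assoc (+ 1) (height w) _) (cong (_+_ (+ 1)) (height+#L≡#R w))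

  balanced⇒height≡0 : ∀ w → Balanced w → height w ≡ 0ℤ
  balanced⇒height≡0 w bal = identityˡ-unique (height w) (+ count L w) (trans (height+#L≡#R w) (cong +_ (sym bal)))

  height≡0⇒balanced : ∀ w → height w ≡ 0ℤ → Balanced w
  height≡0⇒balanced w h≡0 = ℤ.+-injective (begin
    + count L w               ≡⟨ cong (_+ + count L w) h≡0 ⟨
    height w + + count L w    ≡⟨ height+#L≡#R w ⟩
    + count R w               ∎)
    where open ≡-Reasoning
  height-++-flatˡ : ∀ u v → height u ≡ 0ℤ → height (u ++ v) ≡ height v
  height-++-flatˡ u v h≡0 = trans (height-++ u v) (trans (cong (_+ height v) h≡0) (ℤ.+-identityˡ (height v)))

  height-++-flatʳ : ∀ u v → height v ≡ 0ℤ → height (u ++ v) ≡ height u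
  height-++-flatʳ u v h≡0 = trans (height-++ u v) (trans (cong (_+_ (height u)) h≡0) (ℤ.+-identityʳ (height u)))

  height-erase : ∀ a F x → height F ≡ 0ℤ → height (a ++ F ++ x) ≡ height (a ++ x)
  height-erase a F x h≡0 = trans (height-++ a (F ++ x)) (trans (cong (_+_ (height a)) (height-++-flatˡ F x h≡0)) (sym (height-++ a x)))

  PrefixHeights : (ℤ → Set) → Word → Set
  PrefixHeights Q w = ∀ p s → w ≡ p ++ s → NonEmpty p → NonEmpty s → Q (height p)

  Excursion : (ℤ → Set) → Word → Set
  Excursion Q w = NonEmpty w × height w ≡ 0ℤ × PrefixHeights Q w

  Upper Lower : Word → Set
  Upper = Excursion (0ℤ <_)
  Lower = Excursion (_< 0ℤ)

  e≡height∘take : ∀ k w → e k w ≡ height (take k w)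
  e≡height∘take zero    w       = refl
  e≡height∘take (suc k) []      = refl
  e≡height∘take (suc k) (x ∷ w) = cong (_+_ (val x)) (e≡height∘take k w)

  e-length : ∀ p s → e (length p) (p ++ s) ≡ height p
  e-length []      s = refl
  e-length (x ∷ p) s = cong (_+_ (val x)) (e-length p s)

  prime⇒excursion : ∀ {Q P} → IsPrime P × (∀ k → 1 ℕ.≤ k → k ℕ.< length P → Q (e k P)) → Excursion Q P
  prime⇒excursion {Q} {P} ((ne , bal , _) , inside) = ne , balanced⇒height≡0 P bal , prefixes
    where
    prefixes : PrefixHeights Q P
    prefixes p s refl np ns = subst Q (e-length p s)
      (inside (length p) (length-nonEmpty np) (subst (length p ℕ.<_) (sym (length-++ p)) (ℕₚ.m<m+n (length p) (length-nonEmpty ns))))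

  excursion⇒prime : ∀ {Q P} → ¬ Q 0ℤ → Excursion Q P →
                    IsPrime P × (∀ k → 1 ℕ.≤ k → k ℕ.< length P → Q (e k P))
  excursion⇒prime {Q} {P} ¬Q0 (ne , h≡0 , prefixes) = (ne , height≡0⇒balanced P h≡0 , irreducible) , inside
    where
    irreducible : ¬ (∃[ A ] ∃[ B ] (NonEmpty A × Balanced A × NonEmpty B × Balanced B × P ≡ A ++ B))
    irreducible (A , B , nA , bA , nB , _ , P≡AB) = ¬Q0 (subst Q (balanced⇒height≡0 A bA) (prefixes A B P≡AB nA nB))
    inside : ∀ k → 1 ℕ.≤ k → k ℕ.< length P → Q (e k P)
    inside k 1≤k k<∣P∣ = subst Q (sym (e≡height∘take k P))
      (prefixes (take k P) (drop k P) (sym (take++drop≡id k P)) (take-nonEmpty k P 1≤k ne) (drop-nonEmpty k P k<∣P∣))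

  upperPrime⇒upper : ∀ {U} → UpperPrime U → Upper U
  upperPrime⇒upper = prime⇒excursion {0ℤ <_}

  lowerPrime⇒lower : ∀ {D} → LowerPrime D → Lower D
  lowerPrime⇒lower = prime⇒excursion {_< 0ℤ}

  upper⇒upperPrime : ∀ {U} → Upper U → UpperPrime U
  upper⇒upperPrime = excursion⇒prime {0ℤ <_} (ℤ.<-irrefl refl)

  lower⇒lowerPrime : ∀ {D} → Lower D → LowerPrime D
  lower⇒lowerPrime = excursion⇒prime {_< 0ℤ} (ℤ.<-irrefl refl)

  height-swap : ∀ a F G x → height F ≡ 0ℤ → height G ≡ 0ℤ →
                height (a ++ F ++ G ++ x) ≡ height (a ++ G ++ F ++ x)
  height-swap a F G x hF hG = begin
    height (a ++ F ++ G ++ x)  ≡⟨ height-erase a F (G ++ x) hF ⟩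
    height (a ++ G ++ x)       ≡⟨ height-erase a G x hG ⟩
    height (a ++ x)            ≡⟨ height-erase a F x hF ⟨
    height (a ++ F ++ x)       ≡⟨ height-erase a G (F ++ x) hG ⟨
    height (a ++ G ++ F ++ x)  ∎
    where open ≡-Reasoning

  prefixHeights-swap : ∀ {Q} a F G b → NonEmpty a → NonEmpty F → NonEmpty G → height F ≡ 0ℤ → height G ≡ 0ℤ →
                       PrefixHeights Q (a ++ F ++ G ++ b) → PrefixHeights Q (a ++ G ++ F ++ b)
  prefixHeights-swap {Q} a F G b na nF nG hF hG prefixes p s eq np ns
    with ++-equidivisible p s a (G ++ F ++ b) (sym eq)
  ... | inj₁ (m , refl , _) =
        prefixes p (m ++ F ++ G ++ b) (++-assoc p m _) np (++-nonEmptyʳ m (++-nonEmptyˡ _ nF))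
  ... | inj₂ (m , refl , s≡) with ++-equidivisible m s G (F ++ b) (sym s≡)
  ...   | inj₁ (m₂ , refl , _) with empty⊎nonEmpty m₂
  ...     | inj₁ refl = subst Q (sym (height-++-flatʳ a m (trans (cong height (sym (++-identityʳ m))) hG)))
                          (prefixes a (F ++ m ++ b) (cong (a ++_) (solve Words)) na (++-nonEmptyˡ _ nF))
  ...     | inj₂ nm₂ = subst Q (height-erase a F m hF)
                         (prefixes (a ++ F ++ m) (m₂ ++ b) (solve Words) (++-nonEmptyʳ a (++-nonEmptyˡ m nF)) (++-nonEmptyˡ b nm₂))
  prefixHeights-swap {Q} a F G b na nF nG hF hG prefixes _ s eq np ns
      | inj₂ (_ , refl , s≡) | inj₂ (m₃ , refl , s≡′) with ++-equidivisible m₃ s F b (sym s≡′)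
  ...   | inj₁ (m₄ , refl , _) = subst Q (sym (height-erase a G m₃ hG))
          (prefixes (a ++ m₃) (m₄ ++ G ++ b) (solve Words) (++-nonEmptyˡ m₃ na) (++-nonEmptyʳ m₄ (++-nonEmptyˡ b nG)))
  ...   | inj₂ (m₅ , refl , refl) = subst Q (height-swap a F G m₅ hF hG)
          (prefixes (a ++ F ++ G ++ m₅) s (solve Words) (++-nonEmptyʳ a (++-nonEmptyˡ _ nF)) ns)

  excursion-swap : ∀ {Q} → ¬ Q 0ℤ → ∀ a F G b → NonEmpty F → NonEmpty G → height F ≡ 0ℤ → height G ≡ 0ℤ →
                   Excursion Q (a ++ F ++ G ++ b) → Excursion Q (a ++ G ++ F ++ b)
  excursion-swap {Q} ¬Q0 a F G b nF nG hF hG (_ , h≡0 , prefixes) =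
    ++-nonEmptyʳ a (++-nonEmptyˡ (F ++ b) nG) ,
    trans (sym (height-swap a F G b hF hG)) h≡0 ,
    prefixHeights-swap {Q} a F G b na nF nG hF hG prefixes
    where
    -- otherwise F would be a proper prefix of height 0
    na : NonEmpty a
    na a≡[] = ¬Q0 (subst Q hF (prefixes F (G ++ b) (cong (_++ F ++ G ++ b) a≡[]) nF (++-nonEmptyˡ b nG)))

  upper-prefix : ∀ {U} → Upper U → ∀ a m → U ≡ a ++ m → NonEmpty m → 0ℤ ≤ height a
  upper-prefix (_ , _ , prefixes) a m U≡am nm with empty⊎nonEmpty a
  ... | inj₁ refl = ℤ.≤-refl
  ... | inj₂ na   = ℤ.<⇒≤ (prefixes a m U≡am na nm)

  lower-prefix : ∀ {D} → Lower D → ∀ x y → D ≡ x ++ y → height x ≤ 0ℤ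
  lower-prefix (_ , hD , prefixes) x y D≡xy with empty⊎nonEmpty x | empty⊎nonEmpty y
  ... | inj₁ refl | _         = ℤ.≤-refl
  ... | inj₂ nx   | inj₂ ny   = ℤ.<⇒≤ (prefixes x y D≡xy nx ny)
  ... | inj₂ _    | inj₁ refl = ℤ.≤-reflexive (trans (cong height (trans (sym (++-identityʳ x)) (sym D≡xy))) hD)

  cut-inside-first : ∀ {a m m₂ G b} → Upper (a ++ m) → Lower (m₂ ++ G ++ b) → NonEmpty m₂ → NonEmpty G →
                     height (m ++ m₂) ≡ 0ℤ → ⊥
  cut-inside-first {a} {m} {m₂} {G} {b} up@(_ , hU , _) (_ , _ , lowPrefixes) nm₂ nG h≡0 =
    ℤ.<⇒≱ ha<0 (upper-prefix up a m refl nm)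
    where
    hm₂<0 : height m₂ < 0ℤ
    hm₂<0 = lowPrefixes m₂ (G ++ b) refl nm₂ (++-nonEmptyˡ b nG)
    hm>0 : 0ℤ < height m
    hm>0 = subst (0ℤ <_) (sym (x≡-y (height m) (height m₂) (trans (sym (height-++ m m₂)) h≡0))) (ℤ.neg-mono-< hm₂<0)
    ha<0 : height a < 0ℤ
    ha<0 = subst (_< 0ℤ) (sym (x≡-y (height a) (height m) (trans (sym (height-++ a m)) hU))) (ℤ.neg-mono-< hm>0)
    nm : NonEmpty m
    nm m≡[] = ℤ.<-irrefl refl (subst (λ x → 0ℤ < height x) m≡[] hm>0)

  cut-inside-second : ∀ {a F m₃ m₄ b} → Upper (a ++ F ++ m₃) → Lower (m₄ ++ b) → NonEmpty F → NonEmpty m₃ →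
                      height F ≡ 0ℤ → height (m₃ ++ m₄) ≡ 0ℤ → ⊥
  cut-inside-second {a} {F} {m₃} {m₄} {b} (_ , hU , upPrefixes) low nF nm₃ hF h≡0 = ℤ.<⇒≱ haF>0 haF≤0
    where
    haF>0 : 0ℤ < height (a ++ F)
    haF>0 = upPrefixes (a ++ F) m₃ (sym (++-assoc a F m₃)) (++-nonEmptyʳ a nF) nm₃
    hm₃≥0 : 0ℤ ≤ height m₃
    hm₃≥0 = subst (0ℤ ≤_) (sym (x≡-y (height m₃) (height m₄) (trans (sym (height-++ m₃ m₄)) h≡0)))
                  (ℤ.neg-mono-≤ (lower-prefix low m₄ b refl))
    ha≡-hm₃ : height a ≡ - height m₃
    ha≡-hm₃ = x≡-y (height a) (height m₃) (trans (sym (height-++ a m₃)) (trans (sym (height-erase a F m₃ hF)) hU))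
    haF≤0 : height (a ++ F) ≤ 0ℤ
    haF≤0 = subst (_≤ 0ℤ) (sym (trans (height-++-flatʳ a F hF) ha≡-hm₃)) (ℤ.neg-mono-≤ hm₃≥0)

  data SwapSite (U D a F G b : Word) : Set where
    inLower : ∀ m → a ≡ U ++ m → D ≡ m ++ F ++ G ++ b → SwapSite U D a F G b
    inUpper : ∀ m → U ≡ a ++ F ++ G ++ m → b ≡ m ++ D → SwapSite U D a F G b
    whole   : a ≡ [] → b ≡ [] → U ≡ F → D ≡ G → SwapSite U D a F G b

  swapSite-boundary : ∀ {U D a F G b} → Upper U → Lower D → NonEmpty F → NonEmpty G →
                      height F ≡ 0ℤ → height G ≡ 0ℤ → U ≡ a ++ F → D ≡ G ++ b → SwapSite U D a F G b
  swapSite-boundary {a = a} {F} {G} {b} (_ , hU , upPrefixes) (_ , _ , lowPrefixes) nF nG hF hG refl refl =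
    whole a≡[] b≡[] (cong (_++ F) a≡[]) (trans (cong (G ++_) b≡[]) (++-identityʳ G))
    where
    a≡[] : a ≡ []
    a≡[] with empty⊎nonEmpty a
    ... | inj₁ a≡[] = a≡[]
    ... | inj₂ na   = ⊥-elim (ℤ.<-irrefl (sym (trans (sym (height-++-flatʳ a F hF)) hU)) (upPrefixes a F refl na nF))
    b≡[] : b ≡ []
    b≡[] with empty⊎nonEmpty b
    ... | inj₁ b≡[] = b≡[]
    ... | inj₂ nb   = ⊥-elim (ℤ.<-irrefl hG (lowPrefixes G b refl nG nb))

  swapSite : ∀ {U D} a F G b → Upper U → Lower D → NonEmpty F → NonEmpty G → height F ≡ 0ℤ → height G ≡ 0ℤ →
             U ++ D ≡ a ++ F ++ G ++ b → SwapSite U D a F G b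
  swapSite {U} {D} a F G b up low nF nG hF hG eq with ++-equidivisible U D a (F ++ G ++ b) eq
  ... | inj₁ (m , a≡Um , D≡) = inLower m a≡Um D≡
  ... | inj₂ (m , refl , FGb≡mD) with ++-equidivisible m D F (G ++ b) (sym FGb≡mD)
  ...   | inj₁ (m₂ , F≡mm₂ , refl) with empty⊎nonEmpty m₂
  ...     | inj₁ refl = swapSite-boundary up low nF nG hF hG (cong (a ++_) (trans (sym (++-identityʳ m)) (sym F≡mm₂))) refl
  ...     | inj₂ nm₂  = ⊥-elim (cut-inside-first {a} {m} up low nm₂ nG (trans (cong height (sym F≡mm₂)) hF))
  swapSite a F G b up low nF nG hF hG eq
      | inj₂ (_ , refl , _) | inj₂ (m₃ , refl , Gb≡m₃D) with ++-equidivisible m₃ _ G b (sym Gb≡m₃D)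
  ...   | inj₂ (m₅ , refl , b≡m₅D) = inUpper m₅ refl b≡m₅D
  ...   | inj₁ (m₄ , G≡m₃m₄ , refl) with empty⊎nonEmpty m₃
  ...     | inj₁ refl = swapSite-boundary up low nF nG hF hG (cong (a ++_) (++-identityʳ F)) (cong (_++ b) (sym G≡m₃m₄))
  ...     | inj₂ nm₃  = ⊥-elim (cut-inside-second {a} up low nF nm₃ hF (trans (cong height (sym G≡m₃m₄)) hG))

  SignStable : (ℤ → Set) → Set
  SignStable Q = ∀ c x → Q c → c + val x ≢ 0ℤ → Q (c + val x)

  positive-signStable : SignStable (0ℤ <_)
  positive-signStable (+ zero)       _ (+<+ ()) _
  positive-signStable +[1+ n ]       R _ _  = +<+ (s≤s z≤n)
  positive-signStable +[1+ zero ]    L _ ne = ⊥-elim (ne refl)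
  positive-signStable +[1+ suc n ]   L _ _  = +<+ (s≤s z≤n)

  negative-signStable : SignStable (_< 0ℤ)
  negative-signStable (+ _)          _ (+<+ ()) _
  negative-signStable -[1+ n ]       L _ _  = -<+
  negative-signStable -[1+ zero ]    R _ ne = ⊥-elim (ne refl)
  negative-signStable -[1+ suc n ]   R _ _  = -<+

  reachesZero⊎staysIn : ∀ {Q} → SignStable Q → ∀ c w → Q c →
    (∃[ p ] ∃[ s ] (w ≡ p ++ s × NonEmpty s × c + height p ≡ 0ℤ)) ⊎
    (∀ p s → w ≡ p ++ s → NonEmpty s → Q (c + height p))
  reachesZero⊎staysIn stable c [] qc = inj₂ λ p s eq ns → ⊥-elim (ns (++-conicalʳ p s (sym eq)))
  reachesZero⊎staysIn {Q} stable c (x ∷ w) qc with c + val x ≟ 0ℤ | empty⊎nonEmpty w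
  ... | yes c+x≡0 | inj₂ nw = inj₁ (x ∷ [] , w , refl , nw , trans (cong (_+_ c) (ℤ.+-identityʳ (val x))) c+x≡0)
  ... | yes _     | inj₁ refl = inj₂ onlyEmpty
    where
    onlyEmpty : ∀ p s → x ∷ [] ≡ p ++ s → NonEmpty s → Q (c + height p)
    onlyEmpty []      s _  _  = subst Q (sym (ℤ.+-identityʳ c)) qc
    onlyEmpty (_ ∷ p) s eq ns = ⊥-elim (ns (++-conicalʳ p s (sym (proj₂ (∷-injective eq)))))
  ... | no c+x≢0  | _ with reachesZero⊎staysIn stable (c + val x) w (stable c x qc c+x≢0)
  ...   | inj₁ (p , s , refl , ns , ret) = inj₁ (x ∷ p , s , refl , ns , trans (sym (ℤ.+-assoc c (val x) (height p))) ret)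
  ...   | inj₂ stays = inj₂ keeps
    where
    keeps : ∀ p s → x ∷ w ≡ p ++ s → NonEmpty s → Q (c + height p)
    keeps []      s _  _  = subst Q (sym (ℤ.+-identityʳ c)) qc
    keeps (_ ∷ p) s eq ns with ∷-injective eq
    ... | refl , w≡ps = subst Q (ℤ.+-assoc c (val x) (height p)) (stays p s w≡ps ns)

  Reducible : Word → Set
  Reducible w = ∃[ u ] ∃[ v ] (w ≡ u ++ v × NonEmpty u × NonEmpty v × height u ≡ 0ℤ × height v ≡ 0ℤ)

  reducible⊎excursion : ∀ {Q} → SignStable Q → ∀ x w → Q (val x) → height (x ∷ w) ≡ 0ℤ →
                        Reducible (x ∷ w) ⊎ Excursion Q (x ∷ w)
  reducible⊎excursion {Q} stable x w qx h≡0 with reachesZero⊎staysIn stable (val x) w qx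
  ... | inj₁ (p , s , refl , ns , ret) = inj₁ (x ∷ p , s , refl , (λ ()) , ns , ret , hs≡0)
    where
    hs≡0 : height s ≡ 0ℤ
    hs≡0 = trans (sym (height-++-flatˡ (x ∷ p) s ret)) h≡0
  ... | inj₂ stays = inj₂ ((λ ()) , h≡0 , prefixes)
    where
    prefixes : PrefixHeights Q (x ∷ w)
    prefixes []      s _  np _  = ⊥-elim (np refl)
    prefixes (_ ∷ p) s eq _  ns with ∷-injective eq
    ... | refl , w≡ps = stays p s w≡ps ns

  balanced-trichotomy : ∀ w → NonEmpty w → height w ≡ 0ℤ → Reducible w ⊎ Upper w ⊎ Lower w
  balanced-trichotomy []      ne _   = ⊥-elim (ne refl)
  balanced-trichotomy (R ∷ w) _  h≡0 = Sum.map₂ inj₁ (reducible⊎excursion positive-signStable R w (+<+ (s≤s z≤n)) h≡0)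
  balanced-trichotomy (L ∷ w) _  h≡0 = Sum.map₂ inj₂ (reducible⊎excursion negative-signStable L w -<+ h≡0)

  excursion-ends : ∀ {Q w} → Excursion Q w → ∃[ x ] ∃[ X ] ∃[ y ] (w ≡ x ∷ X ++ y ∷ [] × Q (val x) × Q (- val y))
  excursion-ends {Q} {[]}    (ne , _ , _) = ⊥-elim (ne refl)
  excursion-ends {Q} {x ∷ w} (_ , h≡0 , prefixes) with initLast w
  ... | []      = ⊥-elim (val≢0 x (trans (sym (ℤ.+-identityʳ (val x))) h≡0))
    where
    val≢0 : ∀ x → val x ≢ 0ℤ
    val≢0 L ()
    val≢0 R ()
  ... | X ∷ʳ′ y = x , X , y , refl , first , last
    where
    first : Q (val x)
    first = subst Q (ℤ.+-identityʳ (val x)) (prefixes (x ∷ []) (X ++ y ∷ []) refl (λ ()) (++-nonEmptyʳ X (λ ())))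
    last : Q (- val y)
    last = subst Q (x≡-y (height (x ∷ X)) (val y) (trans (sym (height-∷ʳ (x ∷ X) y)) h≡0))
                   (prefixes (x ∷ X) (y ∷ []) refl (λ ()) (λ ()))

  upper-shape : ∀ {F} → Upper F → ∃[ X ] (F ≡ R ∷ X ++ L ∷ [] × height X ≡ 0ℤ)
  upper-shape up@(_ , h≡0 , _) with excursion-ends {0ℤ <_} up
  ... | L , _ , _ , _      , () , _
  ... | R , _ , R , _      , _  , ()
  ... | R , X , L , refl , _  , _ = X , refl , trans (sym (shift (height X))) (trans (cong (_+_ (+ 1)) (sym (height-∷ʳ X L))) h≡0)
    where
    shift : ∀ a → + 1 + (a + - + 1) ≡ a
    shift = solve-∀

  lower-shape : ∀ {F} → Lower F → ∃[ X ] (F ≡ L ∷ X ++ R ∷ [] × height X ≡ 0ℤ)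
  lower-shape low@(_ , h≡0 , _) with excursion-ends {_< 0ℤ} low
  ... | R , _ , _ , _      , +<+ () , _
  ... | L , _ , L , _      , _  , +<+ ()
  ... | L , X , R , refl , _  , _ = X , refl , trans (sym (shift (height X))) (trans (cong (_+_ (- + 1)) (sym (height-∷ʳ X R))) h≡0)
    where
    shift : ∀ a → - + 1 + (a + + 1) ≡ a
    shift = solve-∀

  upper-head : ∀ {U} → Upper U → ∀ Z → head (U ++ Z) ≡ just R
  upper-head up Z with upper-shape up
  ... | _ , refl , _ = refl

  lower-head : ∀ {D} → Lower D → ∀ Z → head (D ++ Z) ≡ just L
  lower-head low Z with lower-shape low
  ... | _ , refl , _ = refl

  upper-swap : ∀ a F G b → NonEmpty F → NonEmpty G → height F ≡ 0ℤ → height G ≡ 0ℤ →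
               Upper (a ++ F ++ G ++ b) → Upper (a ++ G ++ F ++ b)
  upper-swap = excursion-swap {0ℤ <_} (ℤ.<-irrefl refl)

  lower-swap : ∀ a F G b → NonEmpty F → NonEmpty G → height F ≡ 0ℤ → height G ≡ 0ℤ →
               Lower (a ++ F ++ G ++ b) → Lower (a ++ G ++ F ++ b)
  lower-swap = excursion-swap {_< 0ℤ} (ℤ.<-irrefl refl)

-- Connected components of a finite list of links, computed as a labelling that
-- joins the ends of every link and along which P can be transported.
module Labelling {a ℓ} {A : Set a} (_≟_ : DecidableEquality A) (P : A → Set ℓ) where

  record Link : Set (a ⊔ ℓ) where
    constructor link
    field
      source target : A
      forward       : P source → P target
      backward      : P target → P source

  open Link

  Respects : (A → A) → Set (a ⊔ ℓ)
  Respects κ = ∀ x y → κ x ≡ κ y → P x → P y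

  Joins : (A → A) → Link → Set a
  Joins κ e = κ (source e) ≡ κ (target e)

  merge : Link → (A → A) → A → A
  merge e κ x with κ x ≟ κ (target e)
  ... | yes _ = κ (source e)
  ... | no _  = κ x

  merge-respects : ∀ e κ → Respects κ → Respects (merge e κ)
  merge-respects e κ resp x y κx≡κy px with κ x ≟ κ (target e) | κ y ≟ κ (target e)
  ... | yes x∼t | yes y∼t = resp x y (trans x∼t (sym y∼t)) px
  ... | yes x∼t | no _    = resp (source e) y κx≡κy (backward e (resp x (target e) x∼t px))
  ... | no _    | yes y∼t = resp (target e) y (sym y∼t) (forward e (resp x (source e) κx≡κy px))
  ... | no _    | no _    = resp x y κx≡κy px

  merge-keeps : ∀ e κ {x y} → κ x ≡ κ y → merge e κ x ≡ merge e κ y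
  merge-keeps e κ {x} {y} κx≡κy with κ x ≟ κ (target e) | κ y ≟ κ (target e)
  ... | yes _   | yes _   = refl
  ... | yes x∼t | no y≁t  = ⊥-elim (y≁t (trans (sym κx≡κy) x∼t))
  ... | no x≁t  | yes y∼t = ⊥-elim (x≁t (trans κx≡κy y∼t))
  ... | no _    | no _    = κx≡κy

  merge-joins : ∀ e κ → Joins (merge e κ) e
  merge-joins e κ with κ (source e) ≟ κ (target e) | κ (target e) ≟ κ (target e)
  ... | _     | no t≁t = ⊥-elim (t≁t refl)
  ... | yes _ | yes _  = refl
  ... | no _  | yes _  = refl

  label : List Link → A → A
  label es = foldr merge (λ x → x) es

  label-respects : ∀ es → Respects (label es)
  label-respects []       x y x≡y px = subst P x≡y px
  label-respects (e ∷ es) = merge-respects e (label es) (label-respects es)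

  label-joins : ∀ es → All (Joins (label es)) es
  label-joins []       = []
  label-joins (e ∷ es) =
    merge-joins e (label es) ∷ All.map (λ {e′} → merge-keeps e (label es) {source e′} {target e′}) (label-joins es)

open Heights

module FreeAlgebra {c ℓ₁ ℓ₂ : Level} (K : HeytingField c ℓ₁ ℓ₂) where

  open HeytingField K renaming (refl to ≈-refl; sym to ≈-sym; trans to ≈-trans)
  open Alg K
  open import Algebra.Properties.Ring (CommutativeRing.ring (HeytingCommutativeRing.commutativeRing heytingCommutativeRing))
    using (-‿distribˡ-*; -‿+-comm; -0#≈0#; -1*x≈-x; x∙y⁻¹≈ε⇒x≈y; x≈y⇒x∙y⁻¹≈ε; ⁻¹-anti-homo‿-)
  open import Relation.Binary.Reasoning.Setoid setoid

  1#≉0# : ¬ (1# ≈ 0#)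
  1#≉0# 1≈0 = #-irrefl 1≈0 (invertible⇒# (1# , 1*[1-0]≈1 , [1-0]*1≈1))
    where
    1-0≈1 : 1# - 0# ≈ 1#
    1-0≈1 = ≈-trans (+-congˡ -0#≈0#) (+-identityʳ 1#)
    1*[1-0]≈1 : 1# * (1# - 0#) ≈ 1#
    1*[1-0]≈1 = ≈-trans (*-identityˡ _) 1-0≈1
    [1-0]*1≈1 : (1# - 0#) * 1# ≈ 1#
    [1-0]*1≈1 = ≈-trans (*-identityʳ _) 1-0≈1

  linear : (Word → Carrier) → Poly → Carrier
  linear f []            = 0#
  linear f ((k , w) ∷ p) = k * f w + linear f p

  linear-++ : ∀ f p q → linear f (p ++ q) ≈ linear f p + linear f q
  linear-++ f []            q = ≈-sym (+-identityˡ _)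
  linear-++ f ((k , w) ∷ p) q = ≈-trans (+-congˡ (linear-++ f p q)) (≈-sym (+-assoc _ _ _))

  linear-neg : ∀ f p → linear f (neg p) ≈ - linear f p
  linear-neg f []            = ≈-sym -0#≈0#
  linear-neg f ((k , w) ∷ p) = ≈-trans (+-cong (≈-sym (-‿distribˡ-* k (f w))) (linear-neg f p)) (-‿+-comm _ _)

  linear-⊖ : ∀ f p q → linear f (p ⊖ q) ≈ linear f p - linear f q
  linear-⊖ f p q = ≈-trans (linear-++ f p (neg q)) (+-congˡ (linear-neg f q))

  linear-word : ∀ f x → linear f (word x) ≈ f x
  linear-word f x = ≈-trans (+-identityʳ _) (*-identityˡ _)

  linear-word-⊖ : ∀ f x y → linear f (word x ⊖ word y) ≈ f x - f y
  linear-word-⊖ f x y = ≈-trans (linear-⊖ f (word x) (word y)) (+-cong (linear-word f x) (-‿cong (linear-word f y)))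

  linear-cong : ∀ {f g} → (∀ w → f w ≈ g w) → ∀ p → linear f p ≈ linear g p
  linear-cong f≈g []            = ≈-refl
  linear-cong f≈g ((k , w) ∷ p) = +-cong (*-congˡ (f≈g w)) (linear-cong f≈g p)

  linear-sandwich : ∀ f k a t b → linear f (sandwich k a t b) ≈ k * linear (λ v → f (a ++ v ++ b)) t
  linear-sandwich f k a []             b = ≈-sym (zeroʳ k)
  linear-sandwich f k a ((k′ , w) ∷ t) b = begin
    (k * k′) * f (a ++ w ++ b) + linear f (sandwich k a t b)
      ≈⟨ +-cong (*-assoc k k′ _) (linear-sandwich f k a t b) ⟩
    k * (k′ * f (a ++ w ++ b)) + k * linear (λ v → f (a ++ v ++ b)) t
      ≈⟨ distribˡ k _ _ ⟨
    k * (k′ * f (a ++ w ++ b) + linear (λ v → f (a ++ v ++ b)) t) ∎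

  indicator : ∀ {a} {A : Set a} → Dec A → Carrier
  indicator (yes _) = 1#
  indicator (no _)  = 0#

  indicator-spec : ∀ {a} {A : Set a} (d : Dec A) → (A × indicator d ≈ 1#) ⊎ (¬ A × indicator d ≈ 0#)
  indicator-spec (yes a) = inj₁ (a , ≈-refl)
  indicator-spec (no ¬a) = inj₂ (¬a , ≈-refl)

  coeff≈linear : ∀ p w → coeff p w ≈ linear (λ v → indicator (v ≟W w)) p
  coeff≈linear []            w = ≈-refl
  coeff≈linear ((k , v) ∷ p) w with v ≟W w
  ... | yes _ = +-cong (≈-sym (*-identityʳ k)) (coeff≈linear p w)
  ... | no _  = ≈-trans (coeff≈linear p w) (≈-sym (≈-trans (+-congʳ (zeroʳ k)) (+-identityˡ _)))

  ≃-intro : ∀ p q → (∀ f → linear f p ≈ linear f q) → p ≃ q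
  ≃-intro p q eq w = ≈-trans (coeff≈linear p w) (≈-trans (eq _) (≈-sym (coeff≈linear q w)))


  erase : Word → Poly → Poly
  erase w []            = []
  erase w ((k , v) ∷ p) with v ≟W w
  ... | yes _ = erase w p
  ... | no _  = (k , v) ∷ erase w p

  erase-length : ∀ w p → length (erase w p) ℕ.≤ length p
  erase-length w []            = z≤n
  erase-length w ((k , v) ∷ p) with v ≟W w
  ... | yes _ = ℕₚ.m≤n⇒m≤1+n (erase-length w p)
  ... | no _  = s≤s (erase-length w p)

  coeff-erase-self : ∀ w p → coeff (erase w p) w ≈ 0#
  coeff-erase-self w []            = ≈-refl
  coeff-erase-self w ((k , v) ∷ p) with v ≟W w
  ... | yes _ = coeff-erase-self w p
  ... | no v≢w with v ≟W w
  ...   | yes v≡w = ⊥-elim (v≢w v≡w)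
  ...   | no _    = coeff-erase-self w p

  coeff-erase-other : ∀ w v p → v ≢ w → coeff (erase w p) v ≈ coeff p v
  coeff-erase-other w v []            v≢w = ≈-refl
  coeff-erase-other w v ((k , u) ∷ p) v≢w with u ≟W w
  ... | yes refl with u ≟W v
  ...   | yes refl = ⊥-elim (v≢w refl)
  ...   | no _     = coeff-erase-other w v p v≢w
  coeff-erase-other w v ((k , u) ∷ p) v≢w | no _ with u ≟W v
  ...   | yes _ = +-congˡ (coeff-erase-other w v p v≢w)
  ...   | no _  = coeff-erase-other w v p v≢w

  linear-erase : ∀ f w p → linear f p ≈ f w * coeff p w + linear f (erase w p)
  linear-erase f w []            = ≈-sym (≈-trans (+-identityʳ _) (zeroʳ _))
  linear-erase f w ((k , v) ∷ p) with v ≟W w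
  ... | yes refl = begin
      k * f v + linear f p                                   ≈⟨ +-congˡ (linear-erase f v p) ⟩
      k * f v + (f v * coeff p v + linear f (erase v p))     ≈⟨ +-assoc _ _ _ ⟨
      (k * f v + f v * coeff p v) + linear f (erase v p)     ≈⟨ +-congʳ (+-congʳ (*-comm k (f v))) ⟩
      (f v * k + f v * coeff p v) + linear f (erase v p)     ≈⟨ +-congʳ (distribˡ (f v) k _) ⟨
      f v * (k + coeff p v) + linear f (erase v p)           ∎
  ... | no _ = begin
      k * f v + linear f p                                   ≈⟨ +-congˡ (linear-erase f w p) ⟩
      k * f v + (f w * coeff p w + linear f (erase w p))     ≈⟨ +-assoc _ _ _ ⟨
      (k * f v + f w * coeff p w) + linear f (erase w p)     ≈⟨ +-congʳ (+-comm _ _) ⟩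
      (f w * coeff p w + k * f v) + linear f (erase w p)     ≈⟨ +-assoc _ _ _ ⟩
      f w * coeff p w + (k * f v + linear f (erase w p))     ∎

  -- the recursive call is on erase w p, not a subterm of p, hence the length bound n
  linear-vanishes : ∀ f n p → length p ℕ.≤ n → p ≃ [] → linear f p ≈ 0#
  linear-vanishes f n       []            _         _   = ≈-refl
  linear-vanishes f (suc n) ((k , w) ∷ p) (s≤s ∣p∣≤n) p≃0 = begin
      k * f w + linear f p                                 ≈⟨ +-congˡ (linear-erase f w p) ⟩
      k * f w + (f w * coeff p w + linear f (erase w p))   ≈⟨ +-congˡ (+-congˡ erased) ⟩
      k * f w + (f w * coeff p w + 0#)                     ≈⟨ +-congˡ (+-identityʳ _) ⟩
      k * f w + f w * coeff p w                            ≈⟨ +-congʳ (*-comm k (f w)) ⟩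
      f w * k + f w * coeff p w                            ≈⟨ distribˡ (f w) k _ ⟨
      f w * (k + coeff p w)                                ≈⟨ *-congˡ k+coeff≈0 ⟩
      f w * 0#                                             ≈⟨ zeroʳ _ ⟩
      0#                                                   ∎
    where
    k+coeff≈0 : k + coeff p w ≈ 0#
    k+coeff≈0 with p≃0 w
    ... | eq with w ≟W w
    ...   | yes _   = eq
    ...   | no w≢w = ⊥-elim (w≢w refl)
    erase≃0 : erase w p ≃ []
    erase≃0 v with v ≟W w
    ... | yes refl = coeff-erase-self v p
    ... | no v≢w   = ≈-trans (coeff-erase-other w v p v≢w) (coeff-p (p≃0 v))
      where
      coeff-p : coeff ((k , w) ∷ p) v ≈ 0# → coeff p v ≈ 0#
      coeff-p eq with w ≟W v
      ... | yes refl = ⊥-elim (v≢w refl)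
      ... | no _     = eq
    erased : linear f (erase w p) ≈ 0#
    erased = linear-vanishes f n (erase w p) (ℕₚ.≤-trans (erase-length w p) ∣p∣≤n) erase≃0

  linear-resp-≃ : ∀ f p q → p ≃ q → linear f p ≈ linear f q
  linear-resp-≃ f p q p≃q = x∙y⁻¹≈ε⇒x≈y _ _ (begin
    linear f p - linear f q   ≈⟨ linear-⊖ f p q ⟨
    linear f (p ⊖ q)          ≈⟨ linear-vanishes f _ (p ⊖ q) ℕₚ.≤-refl p⊖q≃0 ⟩
    0#                        ∎)
    where
    δ : Word → Word → Carrier
    δ w v = indicator (v ≟W w)
    p⊖q≃0 : (p ⊖ q) ≃ []
    p⊖q≃0 w = ≈-trans (coeff≈linear (p ⊖ q) w) (≈-trans (linear-⊖ (δ w) p q)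
      (x≈y⇒x∙y⁻¹≈ε (≈-trans (≈-sym (coeff≈linear p w)) (≈-trans (p≃q w) (coeff≈linear q w)))))

  private
    telescope : ∀ x y z → (x - y) + (y - z) ≈ x - z
    telescope x y z = begin
      (x - y) + (y - z)    ≈⟨ +-assoc x (- y) (y - z) ⟩
      x + (- y + (y - z))  ≈⟨ +-congˡ (+-assoc (- y) y (- z)) ⟨
      x + ((- y + y) - z)  ≈⟨ +-congˡ (+-congʳ (-‿inverseˡ y)) ⟩
      x + (0# - z)         ≈⟨ +-congˡ (+-identityˡ (- z)) ⟩
      x - z                ∎

  InIdeal-mono : ∀ {p q} {T : Poly → Set p} {T′ : Poly → Set q} → (∀ t → T t → T′ t) →
                 ∀ {x} → InIdeal T x → InIdeal T′ x
  InIdeal-mono T⊆T′ (none x≃0)           = none x≃0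
  InIdeal-mono T⊆T′ (add k a t b Tt r e) = add k a t b (T⊆T′ t Tt) (InIdeal-mono T⊆T′ r) e

  sandwich-resp-≃ : ∀ k a b t t′ → t ≃ t′ → sandwich k a t b ≃ sandwich k a t′ b
  sandwich-resp-≃ k a b t t′ t≃t′ = ≃-intro (sandwich k a t b) (sandwich k a t′ b) λ f →
    ≈-trans (linear-sandwich f k a t b)
      (≈-trans (*-congˡ (linear-resp-≃ (λ v → f (a ++ v ++ b)) t t′ t≃t′)) (≈-sym (linear-sandwich f k a t′ b)))

  module Ideal {p : Level} (T : Poly → Set p) where

    resp-≃ : ∀ {x y} → InIdeal T x → x ≃ y → InIdeal T y
    resp-≃ (none x≃0)           x≃y = none (λ w → ≈-trans (≈-sym (x≃y w)) (x≃0 w))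
    resp-≃ (add k a t b Tt r e) x≃y = add k a t b Tt r (λ w → ≈-trans (≈-sym (x≃y w)) (e w))

    generator : ∀ {t} → T t → InIdeal T t
    generator {t} Tt = add 1# [] t [] Tt (none λ _ → ≈-refl) (≃-intro t (sandwich 1# [] t [] ++ []) λ f → ≈-sym (begin
      linear f (sandwich 1# [] t [] ++ [])  ≈⟨ linear-++ f (sandwich 1# [] t []) [] ⟩
      linear f (sandwich 1# [] t []) + 0#    ≈⟨ +-identityʳ _ ⟩
      linear f (sandwich 1# [] t [])         ≈⟨ linear-sandwich f 1# [] t [] ⟩
      1# * linear (λ v → f (v ++ [])) t      ≈⟨ *-identityˡ _ ⟩
      linear (λ v → f (v ++ [])) t           ≈⟨ linear-cong (λ v → reflexive (cong f (++-identityʳ v))) t ⟩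
      linear f t                             ∎))

    ++-closed : ∀ {x y} → InIdeal T x → InIdeal T y → InIdeal T (x ++ y)
    ++-closed {x} {y} (none x≃0) y∈ = resp-≃ y∈ (≃-intro y (x ++ y) λ f → begin
      linear f y                 ≈⟨ +-identityˡ _ ⟨
      0# + linear f y            ≈⟨ +-congʳ (linear-resp-≃ f x [] x≃0) ⟨
      linear f x + linear f y    ≈⟨ linear-++ f x y ⟨
      linear f (x ++ y)          ∎)
    ++-closed {x} {y} (add {r = r} k a t b Tt r∈ x≃) y∈ =
      add k a t b Tt (++-closed r∈ y∈) (≃-intro (x ++ y) (sandwich k a t b ++ r ++ y) λ f → begin
      linear f (x ++ y)                       ≈⟨ linear-++ f x y ⟩
      linear f x + linear f y                 ≈⟨ +-congʳ (linear-resp-≃ f x (sandwich k a t b ++ r) x≃) ⟩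
      linear f (s ++ r) + linear f y          ≈⟨ +-congʳ (linear-++ f s r) ⟩
      (linear f s + linear f r) + linear f y  ≈⟨ +-assoc _ _ _ ⟩
      linear f s + (linear f r + linear f y)  ≈⟨ +-congˡ (linear-++ f r y) ⟨
      linear f s + linear f (r ++ y)          ≈⟨ linear-++ f s (r ++ y) ⟨
      linear f (s ++ r ++ y)                  ∎)
      where
      s = sandwich k a t b

    sandwich-closed : ∀ {x} k a b → InIdeal T x → InIdeal T (sandwich k a x b)
    sandwich-closed {x} k a b (none x≃0) = none (≃-intro (sandwich k a x b) [] λ f → begin
      linear f (sandwich k a x b)           ≈⟨ linear-sandwich f k a x b ⟩
      k * linear (λ v → f (a ++ v ++ b)) x  ≈⟨ *-congˡ (linear-resp-≃ (λ v → f (a ++ v ++ b)) x [] x≃0) ⟩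
      k * 0#                                ≈⟨ zeroʳ k ⟩
      0#                                    ∎)
    sandwich-closed {x} k a b (add {r = r} k′ a′ t b′ Tt r∈ x≃) =
      add (k * k′) (a ++ a′) t (b′ ++ b) Tt (sandwich-closed k a b r∈)
        (≃-intro (sandwich k a x b) (sandwich (k * k′) (a ++ a′) t (b′ ++ b) ++ sandwich k a r b) λ f →
        let g = λ v → f (a ++ v ++ b)
            s = sandwich k′ a′ t b′
        in begin
        linear f (sandwich k a x b)                                     ≈⟨ linear-sandwich f k a x b ⟩
        k * linear g x                                                  ≈⟨ *-congˡ (linear-resp-≃ g x (sandwich k′ a′ t b′ ++ r) x≃) ⟩
        k * linear g (s ++ r)                                           ≈⟨ *-congˡ (linear-++ g s r) ⟩
        k * (linear g s + linear g r)                                   ≈⟨ distribˡ k _ _ ⟩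
        k * linear g s + k * linear g r                                 ≈⟨ +-congʳ (*-congˡ (linear-sandwich g k′ a′ t b′)) ⟩
        k * (k′ * linear (λ v → g (a′ ++ v ++ b′)) t) + k * linear g r  ≈⟨ +-congʳ (*-assoc k k′ _) ⟨
        (k * k′) * linear (λ v → g (a′ ++ v ++ b′)) t + k * linear g r
          ≈⟨ +-congʳ (*-congˡ (linear-cong (λ v → reflexive (cong f (regroup v))) t)) ⟩
        (k * k′) * linear (λ v → f ((a ++ a′) ++ v ++ b′ ++ b)) t + k * linear g r
          ≈⟨ +-cong (linear-sandwich f (k * k′) (a ++ a′) t (b′ ++ b)) (linear-sandwich f k a r b) ⟨
        linear f (sandwich (k * k′) (a ++ a′) t (b′ ++ b)) + linear f (sandwich k a r b)
          ≈⟨ linear-++ f (sandwich (k * k′) (a ++ a′) t (b′ ++ b)) (sandwich k a r b) ⟨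
        linear f (sandwich (k * k′) (a ++ a′) t (b′ ++ b) ++ sandwich k a r b) ∎)
      where
      regroup : ∀ v → a ++ (a′ ++ v ++ b′) ++ b ≡ (a ++ a′) ++ v ++ b′ ++ b
      regroup v = solve Words

    infix 4 _≋_
    _≋_ : Word → Word → Set (c ⊔ ℓ₁ ⊔ p)
    x ≋ y = InIdeal T (word x ⊖ word y)

    ≋-refl : ∀ {x} → x ≋ x
    ≋-refl {x} = none (≃-intro (word x ⊖ word x) [] λ f → ≈-trans (linear-word-⊖ f x x) (-‿inverseʳ (f x)))

    ≋-reflexive : ∀ {x y} → x ≡ y → x ≋ y
    ≋-reflexive refl = ≋-refl

    ≋-sym : ∀ {x y} → x ≋ y → y ≋ x
    ≋-sym {x} {y} x≋y = resp-≃ (sandwich-closed (- 1#) [] [] x≋y)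
      (≃-intro (sandwich (- 1#) [] (word x ⊖ word y) []) (word y ⊖ word x) λ f → begin
      linear f (sandwich (- 1#) [] (word x ⊖ word y) [])   ≈⟨ linear-sandwich f (- 1#) [] (word x ⊖ word y) [] ⟩
      - 1# * linear (λ v → f (v ++ [])) (word x ⊖ word y)  ≈⟨ -1*x≈-x _ ⟩
      - linear (λ v → f (v ++ [])) (word x ⊖ word y)       ≈⟨ -‿cong (linear-word-⊖ (λ v → f (v ++ [])) x y) ⟩
      - (f (x ++ []) - f (y ++ []))                        ≈⟨ ⁻¹-anti-homo‿- _ _ ⟩
      f (y ++ []) - f (x ++ [])
        ≈⟨ +-cong (reflexive (cong f (++-identityʳ y))) (-‿cong (reflexive (cong f (++-identityʳ x)))) ⟩
      f y - f x                                            ≈⟨ linear-word-⊖ f y x ⟨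
      linear f (word y ⊖ word x)                           ∎)

    ≋-trans : ∀ {x y z} → x ≋ y → y ≋ z → x ≋ z
    ≋-trans {x} {y} {z} x≋y y≋z = resp-≃ (++-closed x≋y y≋z)
      (≃-intro ((word x ⊖ word y) ++ (word y ⊖ word z)) (word x ⊖ word z) λ f → begin
      linear f ((word x ⊖ word y) ++ (word y ⊖ word z))         ≈⟨ linear-++ f (word x ⊖ word y) (word y ⊖ word z) ⟩
      linear f (word x ⊖ word y) + linear f (word y ⊖ word z)   ≈⟨ +-cong (linear-word-⊖ f x y) (linear-word-⊖ f y z) ⟩
      (f x - f y) + (f y - f z)                                 ≈⟨ telescope _ _ _ ⟩
      f x - f z                                                 ≈⟨ linear-word-⊖ f x z ⟨
      linear f (word x ⊖ word z)                                ∎)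

    ≋-cong : ∀ {x y} a b → x ≋ y → a ++ x ++ b ≋ a ++ y ++ b
    ≋-cong {x} {y} a b x≋y = resp-≃ (sandwich-closed 1# a b x≋y)
      (≃-intro (sandwich 1# a (word x ⊖ word y) b) (word (a ++ x ++ b) ⊖ word (a ++ y ++ b)) λ f → begin
      linear f (sandwich 1# a (word x ⊖ word y) b)              ≈⟨ linear-sandwich f 1# a (word x ⊖ word y) b ⟩
      1# * linear (λ v → f (a ++ v ++ b)) (word x ⊖ word y)     ≈⟨ *-identityˡ _ ⟩
      linear (λ v → f (a ++ v ++ b)) (word x ⊖ word y)          ≈⟨ linear-word-⊖ (λ v → f (a ++ v ++ b)) x y ⟩
      f (a ++ x ++ b) - f (a ++ y ++ b)                         ≈⟨ linear-word-⊖ f (a ++ x ++ b) (a ++ y ++ b) ⟨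
      linear f (word (a ++ x ++ b) ⊖ word (a ++ y ++ b))        ∎)

    ≋-congˡ : ∀ {x y} a → x ≋ y → a ++ x ≋ a ++ y
    ≋-congˡ {x} {y} a x≋y = ≋-trans (≋-reflexive (cong (a ++_) (sym (++-identityʳ x))))
      (≋-trans (≋-cong a [] x≋y) (≋-reflexive (cong (a ++_) (++-identityʳ y))))

    ≋-congʳ : ∀ {x y} b → x ≋ y → x ++ b ≋ y ++ b
    ≋-congʳ = ≋-cong []

    ≋-setoid : Setoid _ _
    ≋-setoid = record
      { Carrier       = Word
      ; _≈_           = _≋_
      ; isEquivalence = record { refl = ≋-refl ; sym = ≋-sym ; trans = ≋-trans }
      }

    module ≋-Reasoning = Relation.Binary.Reasoning.Setoid ≋-setoid

    sandwich-∈ : ∀ k a t b F G → t ≃ commutator F G → F ++ G ≋ G ++ F → InIdeal T (sandwich k a t b)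
    sandwich-∈ k a t b F G t≃ FG≋GF =
      resp-≃ (sandwich-closed k a b FG≋GF) (sandwich-resp-≃ k a b (commutator F G) t (λ w → ≈-sym (t≃ w)))

    ∈ₚ⇒≋ : ∀ x y → commutator x y ∈ₚ T → x ++ y ≋ y ++ x
    ∈ₚ⇒≋ x y (q , Tq , q≃) = resp-≃ (generator Tq) q≃

  swap-∼ : ∀ a F G b → NonEmpty F → Balanced F → NonEmpty G → Balanced G → (a ++ F ++ G ++ b) ∼ (a ++ G ++ F ++ b)
  swap-∼ a F G b nF bF nG bG =
    subst₂ _∼_ (regroup F G) (regroup G F) (≋-cong a b (generator (F , G , nF , bF , nG , bG , λ _ → ≈-refl)))
    where
    open Ideal InS
    regroup : ∀ x y → a ++ (x ++ y) ++ b ≡ a ++ x ++ y ++ b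
    regroup x y = solve Words

  SwapWitness : ∀ {p} → (Poly → Set p) → Word → Word → Set (c ⊔ ℓ₁ ⊔ p)
  SwapWitness T U D = ∃[ U′ ] ∃[ D′ ] (U′ ∼ U × D′ ∼ D × ((commutator U′ D′ ∈ₚ T) ⊎ (commutator D′ U′ ∈ₚ T)))

  linear-sandwich-commutator : ∀ f k a t b F G → t ≃ commutator F G →
    linear f (sandwich k a t b) ≈ k * (f (a ++ F ++ G ++ b) - f (a ++ G ++ F ++ b))
  linear-sandwich-commutator f k a t b F G t≃ = begin
    linear f (sandwich k a t b)                           ≈⟨ linear-sandwich f k a t b ⟩
    k * linear g t                                        ≈⟨ *-congˡ (linear-resp-≃ g t (commutator F G) t≃) ⟩
    k * linear g (commutator F G)                         ≈⟨ *-congˡ (linear-word-⊖ g (F ++ G) (G ++ F)) ⟩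
    k * (f (a ++ (F ++ G) ++ b) - f (a ++ (G ++ F) ++ b))
      ≈⟨ *-congˡ (+-cong (reflexive (cong f (regroup F G))) (-‿cong (reflexive (cong f (regroup G F))))) ⟩
    k * (f (a ++ F ++ G ++ b) - f (a ++ G ++ F ++ b))     ∎
    where
    g = λ v → f (a ++ v ++ b)
    regroup : ∀ x y → a ++ (x ++ y) ++ b ≡ a ++ x ++ y ++ b
    regroup x y = solve Words

  linear-sandwich-vanishes : ∀ f k a t b F G → t ≃ commutator F G → f (a ++ F ++ G ++ b) ≈ f (a ++ G ++ F ++ b) →
                             linear f (sandwich k a t b) ≈ 0#
  linear-sandwich-vanishes f k a t b F G t≃ same = begin
    linear f (sandwich k a t b)                        ≈⟨ linear-sandwich-commutator f k a t b F G t≃ ⟩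
    k * (f (a ++ F ++ G ++ b) - f (a ++ G ++ F ++ b))  ≈⟨ *-congˡ (x≈y⇒x∙y⁻¹≈ε same) ⟩
    k * 0#                                             ≈⟨ zeroʳ k ⟩
    0#                                                 ∎

  SwapInvariant : (Word → Carrier) → Set _
  SwapInvariant f = ∀ a F G b → NonEmpty F → Balanced F → NonEmpty G → Balanced G →
                    f (a ++ F ++ G ++ b) ≈ f (a ++ G ++ F ++ b)

  swapInvariant⇒vanishes-on-J : ∀ f → SwapInvariant f → ∀ {q} → J q → linear f q ≈ 0#
  swapInvariant⇒vanishes-on-J f inv {q} (none q≃0) = linear-resp-≃ f q [] q≃0
  swapInvariant⇒vanishes-on-J f inv {q} (add {r = r} k a t b (F , G , nF , bF , nG , bG , t≃) r∈ q≃) = begin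
    linear f q                                ≈⟨ linear-resp-≃ f q (sandwich k a t b ++ r) q≃ ⟩
    linear f (sandwich k a t b ++ r)          ≈⟨ linear-++ f (sandwich k a t b) r ⟩
    linear f (sandwich k a t b) + linear f r
      ≈⟨ +-cong (linear-sandwich-vanishes f k a t b F G t≃ (inv a F G b nF bF nG bG)) (swapInvariant⇒vanishes-on-J f inv r∈) ⟩
    0# + 0#                                   ≈⟨ +-identityʳ 0# ⟩
    0#                                        ∎


  restrict : ℕ → (Word → Carrier) → Word → Carrier
  restrict n f w with length w ℕ.≟ n
  ... | yes _ = f w
  ... | no _  = 0#

  restrict-≡ : ∀ n f w → length w ≡ n → restrict n f w ≈ f w
  restrict-≡ n f w ∣w∣≡n with length w ℕ.≟ n
  ... | yes _    = ≈-refl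
  ... | no ∣w∣≢n = ⊥-elim (∣w∣≢n ∣w∣≡n)

  restrict-≢ : ∀ n f w → length w ≢ n → restrict n f w ≈ 0#
  restrict-≢ n f w ∣w∣≢n with length w ℕ.≟ n
  ... | yes ∣w∣≡n = ⊥-elim (∣w∣≢n ∣w∣≡n)
  ... | no _      = ≈-refl

  restrict-resp-length : ∀ n f {v w} → length v ≡ length w → f v ≈ f w → restrict n f v ≈ restrict n f w
  restrict-resp-length n f {v} {w} ∣v∣≡∣w∣ fv≈fw with length v ℕ.≟ n | length w ℕ.≟ n
  ... | yes _     | yes _     = fv≈fw
  ... | no _      | no _      = ≈-refl
  ... | yes ∣v∣≡n | no ∣w∣≢n  = ⊥-elim (∣w∣≢n (trans (sym ∣v∣≡∣w∣) ∣v∣≡n))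
  ... | no ∣v∣≢n  | yes ∣w∣≡n = ⊥-elim (∣v∣≢n (trans ∣v∣≡∣w∣ ∣w∣≡n))

  component : ℕ → Poly → Poly
  component n []            = []
  component n ((k , w) ∷ p) with length w ℕ.≟ n
  ... | yes _ = (k , w) ∷ component n p
  ... | no _  = component n p

  linear-component : ∀ f n p → linear f (component n p) ≈ linear (restrict n f) p
  linear-component f n []            = ≈-refl
  linear-component f n ((k , w) ∷ p) with length w ℕ.≟ n
  ... | yes _ = +-congˡ (linear-component f n p)
  ... | no _  = ≈-trans (linear-component f n p) (≈-sym (≈-trans (+-congʳ (zeroʳ k)) (+-identityˡ _)))

  linear-component-sandwich : ∀ f n k a t b r q F G → q ≃ (sandwich k a t b ++ r) → t ≃ commutator F G →
    linear f (component n q) ≈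
    k * (restrict n f (a ++ F ++ G ++ b) - restrict n f (a ++ G ++ F ++ b)) + linear f (component n r)
  linear-component-sandwich f n k a t b r q F G q≃ t≃ = begin
    linear f (component n q)                                            ≈⟨ linear-component f n q ⟩
    linear (restrict n f) q                                             ≈⟨ linear-resp-≃ (restrict n f) q (sandwich k a t b ++ r) q≃ ⟩
    linear (restrict n f) (sandwich k a t b ++ r)                       ≈⟨ linear-++ (restrict n f) (sandwich k a t b) r ⟩
    linear (restrict n f) (sandwich k a t b) + linear (restrict n f) r
      ≈⟨ +-cong (linear-sandwich-commutator (restrict n f) k a t b F G t≃) (≈-sym (linear-component f n r)) ⟩
    k * (restrict n f (a ++ F ++ G ++ b) - restrict n f (a ++ G ++ F ++ b)) + linear f (component n r) ∎

  ∼⇒length≡ : ∀ {x y} → x ∼ y → length x ≡ length y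
  ∼⇒length≡ {x} {y} x∼y with length x ℕ.≟ length y
  ... | yes ∣x∣≡∣y∣ = ∣x∣≡∣y∣
  ... | no ∣x∣≢∣y∣  = ⊥-elim (1#≉0# (begin
    1#   ≈⟨ restrict-≡ (length y) one y refl ⟨
    f y  ≈⟨ fx≈fy ⟨
    f x  ≈⟨ restrict-≢ (length y) one x ∣x∣≢∣y∣ ⟩
    0#   ∎))
    where
    one : Word → Carrier
    one _ = 1#
    f : Word → Carrier
    f = restrict (length y) one
    invariant : SwapInvariant f
    invariant a F G b _ _ _ _ = restrict-resp-length (length y) one {a ++ F ++ G ++ b} {a ++ G ++ F ++ b} (length-swap a F G b) ≈-refl
    fx≈fy : f x ≈ f y
    fx≈fy = x∙y⁻¹≈ε⇒x≈y (f x) (f y) (≈-trans (≈-sym (linear-word-⊖ f x y)) (swapInvariant⇒vanishes-on-J f invariant x∼y))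

module IfDirection {c ℓ₁ ℓ₂ p : Level} (K : HeytingField c ℓ₁ ℓ₂) (Sstar : Alg.Poly K → Set p) where

  open HeytingField K renaming (refl to ≈-refl; sym to ≈-sym; trans to ≈-trans)
  open Alg K
  open FreeAlgebra K
  open Ideal Sstar
  private
    module ≈-Reasoning = Relation.Binary.Reasoning.Setoid setoid

  Commute : ℕ → Set (c ⊔ ℓ₁ ⊔ p)
  Commute n = ∀ F G → height F ≡ 0ℤ → height G ≡ 0ℤ → length (F ++ G) ℕ.≤ n → F ++ G ≋ G ++ F

  Commute-mono : ∀ {m n} → m ℕ.≤ n → Commute n → Commute m
  Commute-mono m≤n comm F G hF hG ∣FG∣≤m = comm F G hF hG (ℕₚ.≤-trans ∣FG∣≤m m≤n)

  -- the degree-n component of an element of J only involves commutators of degree n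
  component-∈ : ∀ n → Commute n → ∀ {q} → J q → InIdeal Sstar (component n q)
  component-∈ n comm {q} (none q≃0) = none (≃-intro (component n q) [] λ f →
    ≈-trans (linear-component f n q) (linear-resp-≃ (restrict n f) q [] q≃0))
  component-∈ n comm {q} (add {r = r} k a t b (F , G , nF , bF , nG , bG , t≃) r∈ q≃)
    with length (a ++ F ++ G ++ b) ℕ.≟ n
  ... | yes ∣w∣≡n = resp-≃ (++-closed term∈ (component-∈ n comm r∈))
          (≃-intro (sandwich k a t b ++ component n r) (component n q) λ f → ≈-sym (begin
            linear f (component n q)                                          ≈⟨ linear-component-sandwich f n k a t b r q F G q≃ t≃ ⟩
            k * (restrict n f (a ++ F ++ G ++ b) - restrict n f (a ++ G ++ F ++ b)) + linear f (component n r)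
              ≈⟨ +-congʳ (*-congˡ (+-cong (restrict-≡ n f (a ++ F ++ G ++ b) ∣w∣≡n) (-‿cong (restrict-≡ n f (a ++ G ++ F ++ b) ∣w′∣≡n)))) ⟩
            k * (f (a ++ F ++ G ++ b) - f (a ++ G ++ F ++ b)) + linear f (component n r)
              ≈⟨ +-congʳ (linear-sandwich-commutator f k a t b F G t≃) ⟨
            linear f (sandwich k a t b) + linear f (component n r)            ≈⟨ linear-++ f (sandwich k a t b) (component n r) ⟨
            linear f (sandwich k a t b ++ component n r)                      ∎))
    where
    open ≈-Reasoning
    ∣w′∣≡n : length (a ++ G ++ F ++ b) ≡ n
    ∣w′∣≡n = trans (sym (length-swap a F G b)) ∣w∣≡n
    ∣FG∣≤n : length (F ++ G) ℕ.≤ n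
    ∣FG∣≤n = subst (length (F ++ G) ℕ.≤_) (trans (cong (λ w → length (a ++ w)) (++-assoc F G b)) ∣w∣≡n) (length-infix-≤ a (F ++ G) b)
    term∈ : InIdeal Sstar (sandwich k a t b)
    term∈ = sandwich-∈ k a t b F G t≃ (comm F G (balanced⇒height≡0 F bF) (balanced⇒height≡0 G bG) ∣FG∣≤n)
  ... | no ∣w∣≢n = resp-≃ (component-∈ n comm r∈) (≃-intro (component n r) (component n q) λ f → ≈-sym (begin
            linear f (component n q)                                          ≈⟨ linear-component-sandwich f n k a t b r q F G q≃ t≃ ⟩
            k * (restrict n f (a ++ F ++ G ++ b) - restrict n f (a ++ G ++ F ++ b)) + linear f (component n r)
              ≈⟨ +-congʳ (*-congˡ (+-cong (restrict-≢ n f (a ++ F ++ G ++ b) ∣w∣≢n) (-‿cong (restrict-≢ n f (a ++ G ++ F ++ b) ∣w′∣≢n)))) ⟩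
            k * (0# - 0#) + linear f (component n r)                          ≈⟨ +-congʳ (≈-trans (*-congˡ (-‿inverseʳ 0#)) (zeroʳ k)) ⟩
            0# + linear f (component n r)                                     ≈⟨ +-identityˡ _ ⟩
            linear f (component n r)                                          ∎))
    where
    open ≈-Reasoning
    ∣w′∣≢n : length (a ++ G ++ F ++ b) ≢ n
    ∣w′∣≢n eq = ∣w∣≢n (trans (length-swap a F G b) eq)

  ∼⇒≋ : ∀ {x y} → Commute (length y) → x ∼ y → x ≋ y
  ∼⇒≋ {x} {y} comm x∼y = resp-≃ (component-∈ n comm x∼y)
    (≃-intro (component n (word x ⊖ word y)) (word x ⊖ word y) λ f → begin
    linear f (component n (word x ⊖ word y))  ≈⟨ linear-component f n (word x ⊖ word y) ⟩
    linear (restrict n f) (word x ⊖ word y)   ≈⟨ linear-word-⊖ (restrict n f) x y ⟩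
    restrict n f x - restrict n f y           ≈⟨ +-cong (restrict-≡ n f x (∼⇒length≡ x∼y)) (-‿cong (restrict-≡ n f y refl)) ⟩
    f x - f y                                 ≈⟨ linear-word-⊖ f x y ⟨
    linear f (word x ⊖ word y)                ∎)
    where
    open ≈-Reasoning
    n = length y

  Hypothesis : Set (c ⊔ ℓ₁ ⊔ p)
  Hypothesis = ∀ U D → UpperPrime U → LowerPrime D → SwapWitness Sstar U D

  private
    <-≤-pred : ∀ {m k n} → m ℕ.< k → k ℕ.≤ suc n → m ℕ.≤ n
    <-≤-pred m<k k≤1+n = ℕₚ.≤-pred (ℕₚ.<-≤-trans m<k k≤1+n)

  commute-reducible : ∀ {n} → Commute n → ∀ A B G → NonEmpty A → NonEmpty B →
                      height A ≡ 0ℤ → height B ≡ 0ℤ → height G ≡ 0ℤ →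
                      length ((A ++ B) ++ G) ℕ.≤ suc n → (A ++ B) ++ G ≋ G ++ A ++ B
  commute-reducible comm A B G nA nB hA hB hG ∣w∣≤1+n = begin
    (A ++ B) ++ G  ≡⟨ ++-assoc A B G ⟩
    A ++ B ++ G    ≈⟨ ≋-congˡ A (comm B G hB hG (<-≤-pred (length-++-<ˡ A (B ++ G) nA) ∣w∣≤1+n′)) ⟩
    A ++ G ++ B    ≡⟨ ++-assoc A G B ⟨
    (A ++ G) ++ B  ≈⟨ ≋-congʳ B (comm A G hA hG (<-≤-pred (length-erase-< A B G nB) ∣w∣≤1+n′)) ⟩
    (G ++ A) ++ B  ≡⟨ ++-assoc G A B ⟩
    G ++ A ++ B    ∎
    where
    open ≋-Reasoning
    ∣w∣≤1+n′ : length (A ++ B ++ G) ℕ.≤ suc _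
    ∣w∣≤1+n′ = subst (ℕ._≤ suc _) (cong length (++-assoc A B G)) ∣w∣≤1+n

  -- two excursions of the same sign have the form r X l and r Y l
  commute-wrapped : ∀ {n} → Commute n → ∀ r l X Y → NonEmpty r →
                    height X ≡ 0ℤ → height Y ≡ 0ℤ → height (l ++ r) ≡ 0ℤ →
                    length ((r ++ X ++ l) ++ r ++ Y ++ l) ℕ.≤ suc n →
                    (r ++ X ++ l) ++ r ++ Y ++ l ≋ (r ++ Y ++ l) ++ r ++ X ++ l
  commute-wrapped comm r l X Y nr hX hY hlr ∣w∣≤1+n = begin
    (r ++ X ++ l) ++ r ++ Y ++ l       ≡⟨ regroup₁ ⟩
    r ++ (X ++ W) ++ l                 ≈⟨ ≋-cong r l (comm X W hX hW ∣XW∣≤n) ⟩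
    r ++ (W ++ X) ++ l                 ≡⟨ regroup₂ ⟩
    r ++ W ++ X ++ l                   ≈⟨ ≋-cong r (X ++ l) (comm (l ++ r) Y hlr hY ∣lrY∣≤n) ⟩
    r ++ (Y ++ l ++ r) ++ X ++ l       ≡⟨ regroup₃ ⟩
    (r ++ Y ++ l) ++ r ++ X ++ l       ∎
    where
    open ≋-Reasoning
    W = (l ++ r) ++ Y
    hW : height W ≡ 0ℤ
    hW = trans (height-++-flatˡ (l ++ r) Y hlr) hY
    regroup₁ : (r ++ X ++ l) ++ r ++ Y ++ l ≡ r ++ (X ++ W) ++ l
    regroup₁ = solve Words
    regroup₂ : r ++ (W ++ X) ++ l ≡ r ++ W ++ X ++ l
    regroup₂ = cong (r ++_) (++-assoc W X l)
    regroup₃ : r ++ (Y ++ l ++ r) ++ X ++ l ≡ (r ++ Y ++ l) ++ r ++ X ++ l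
    regroup₃ = solve Words
    ∣XW∣≤n : length (X ++ W) ℕ.≤ _
    ∣XW∣≤n = <-≤-pred (length-infix-< r (X ++ W) l nr)
                      (subst (ℕ._≤ suc _) (cong length regroup₁) ∣w∣≤1+n)
    ∣lrY∣≤n : length W ℕ.≤ _
    ∣lrY∣≤n = <-≤-pred (length-infix-< r W (X ++ l) nr)
                       (subst (ℕ._≤ suc _) (trans (cong length (trans regroup₁ (cong (r ++_) (++-assoc X W l)))) (length-swap r X W l)) ∣w∣≤1+n)

  commute-upper-lower : ∀ {n} → Hypothesis → Commute n → ∀ F G → Upper F → Lower G →
                        length (F ++ G) ℕ.≤ suc n → F ++ G ≋ G ++ F
  commute-upper-lower hyp comm F G upF lowG ∣FG∣≤1+n
    with hyp F G (upper⇒upperPrime upF) (lower⇒lowerPrime lowG)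
  ... | U′ , D′ , U′∼F , D′∼G , witness = begin
    F ++ G    ≈⟨ ≋-congʳ G (≋-sym U′≋F) ⟩
    U′ ++ G   ≈⟨ ≋-congˡ U′ (≋-sym D′≋G) ⟩
    U′ ++ D′  ≈⟨ [ ∈ₚ⇒≋ U′ D′ , (λ DU∈ → ≋-sym (∈ₚ⇒≋ D′ U′ DU∈)) ]′ witness ⟩
    D′ ++ U′  ≈⟨ ≋-congʳ U′ D′≋G ⟩
    G ++ U′   ≈⟨ ≋-congˡ G U′≋F ⟩
    G ++ F    ∎
    where
    open ≋-Reasoning
    U′≋F : U′ ≋ F
    U′≋F = ∼⇒≋ (Commute-mono (<-≤-pred (length-++-<ʳ F G (proj₁ lowG)) ∣FG∣≤1+n) comm) U′∼F
    D′≋G : D′ ≋ G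
    D′≋G = ∼⇒≋ (Commute-mono (<-≤-pred (length-++-<ˡ F G (proj₁ upF)) ∣FG∣≤1+n) comm) D′∼G

  commute-step : ∀ {n} → Hypothesis → Commute n → Commute (suc n)
  commute-step hyp comm F G hF hG ∣FG∣≤1+n with empty⊎nonEmpty F | empty⊎nonEmpty G
  ... | inj₁ refl | _         = ≋-reflexive (sym (++-identityʳ G))
  ... | inj₂ _    | inj₁ refl = ≋-reflexive (++-identityʳ F)
  ... | inj₂ nF   | inj₂ nG   with balanced-trichotomy F nF hF | balanced-trichotomy G nG hG
  ...   | inj₁ (A , B , refl , nA , nB , hA , hB) | _ =
          commute-reducible comm A B G nA nB hA hB hG ∣FG∣≤1+n
  ...   | inj₂ _ | inj₁ (A , B , refl , nA , nB , hA , hB) =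
          ≋-sym (commute-reducible comm A B F nA nB hA hB hF (subst (ℕ._≤ suc _) (length-++-comm F (A ++ B)) ∣FG∣≤1+n))
  ...   | inj₂ (inj₁ upF) | inj₂ (inj₂ lowG) = commute-upper-lower hyp comm F G upF lowG ∣FG∣≤1+n
  ...   | inj₂ (inj₂ lowF) | inj₂ (inj₁ upG) =
          ≋-sym (commute-upper-lower hyp comm G F upG lowF (subst (ℕ._≤ suc _) (length-++-comm F G) ∣FG∣≤1+n))
  ...   | inj₂ (inj₁ upF) | inj₂ (inj₁ upG) with upper-shape upF | upper-shape upG
  ...     | X , refl , hX | Y , refl , hY = commute-wrapped comm (R ∷ []) (L ∷ []) X Y (λ ()) hX hY refl ∣FG∣≤1+n
  commute-step hyp comm F G hF hG ∣FG∣≤1+n | inj₂ _ | inj₂ _ | inj₂ (inj₂ lowF) | inj₂ (inj₂ lowG)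
    with lower-shape lowF | lower-shape lowG
  ...     | X , refl , hX | Y , refl , hY = commute-wrapped comm (L ∷ []) (R ∷ []) X Y (λ ()) hX hY refl ∣FG∣≤1+n

  commute : Hypothesis → ∀ n → Commute n
  commute hyp zero    []      []      _ _ _  = ≋-refl
  commute hyp zero    []      (_ ∷ _) _ _ ()
  commute hyp zero    (_ ∷ _) _       _ _ ()
  commute hyp (suc n) = commute-step hyp (commute hyp n)

  J⊆ideal : Hypothesis → ∀ {q} → J q → InIdeal Sstar q
  J⊆ideal hyp (none q≃0) = none q≃0
  J⊆ideal hyp {q} (add {r = r} k a t b (F , G , _ , bF , _ , bG , t≃) r∈ q≃) =
    resp-≃ (++-closed (sandwich-∈ k a t b F G t≃ FG≋GF) (J⊆ideal hyp r∈)) (λ w → ≈-sym (q≃ w))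
    where
    FG≋GF : F ++ G ≋ G ++ F
    FG≋GF = commute hyp (length (F ++ G)) F G (balanced⇒height≡0 F bF) (balanced⇒height≡0 G bG) ℕₚ.≤-refl

  if-direction : SubsetOfS Sstar → Hypothesis → GeneratesJ Sstar
  if-direction S⋆⊆S hyp q = InIdeal-mono S⋆⊆S , J⊆ideal hyp

module OnlyIfDirection {c ℓ₁ ℓ₂ p : Level} (K : HeytingField c ℓ₁ ℓ₂)
                       (Sstar : Alg.Poly K → Set p) (S⋆⊆S : Alg.SubsetOfS K Sstar) where

  open HeytingField K renaming (refl to ≈-refl; sym to ≈-sym; trans to ≈-trans)
  open Alg K
  open FreeAlgebra K
  open Ideal InS using () renaming (≋-refl to ∼-refl; ≋-sym to ∼-sym; ≋-trans to ∼-trans; generator to J-generator)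
  open import Relation.Binary.Reasoning.Setoid setoid

  record Factorisation (U D W : Word) : Set (c ⊔ ℓ₁) where
    constructor factorisation
    field
      upper lower : Word
      splits      : W ≡ upper ++ lower
      isUpper     : Upper upper
      isLower     : Lower lower
      upper∼U     : upper ∼ U
      lower∼D     : lower ∼ D

  factorisation-head : ∀ {U D W} → Factorisation U D W → head W ≡ just R
  factorisation-head (factorisation _ D′ refl up _ _ _) = upper-head up D′

  data SwapOutcome (U D a F G b : Word) : Set (c ⊔ ℓ₁) where
    inside : Factorisation U D (a ++ G ++ F ++ b) → SwapOutcome U D a F G b
    flip   : a ≡ [] → b ≡ [] → Upper F → Lower G → F ∼ U → G ∼ D → SwapOutcome U D a F G b

  swap-factorisation : ∀ {U D} a F G b → NonEmpty F → Balanced F → NonEmpty G → Balanced G →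
                       Factorisation U D (a ++ F ++ G ++ b) → SwapOutcome U D a F G b
  swap-factorisation a F G b nF bF nG bG (factorisation U′ D′ W≡ up low U′∼U D′∼D)
    with swapSite a F G b up low nF nG (balanced⇒height≡0 F bF) (balanced⇒height≡0 G bG) (sym W≡)
  ... | inLower m refl refl =
        inside (factorisation U′ (m ++ G ++ F ++ b) (++-assoc U′ m _) up
                  (lower-swap m F G b nF nG (balanced⇒height≡0 F bF) (balanced⇒height≡0 G bG) low)
                  U′∼U (∼-trans (∼-sym (swap-∼ m F G b nF bF nG bG)) D′∼D))
  ... | inUpper m refl refl =
        inside (factorisation (a ++ G ++ F ++ m) D′ (solve Words)
                  (upper-swap a F G m nF nG (balanced⇒height≡0 F bF) (balanced⇒height≡0 G bG) up) low
                  (∼-trans (∼-sym (swap-∼ a F G m nF bF nG bG)) U′∼U) D′∼D)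
  ... | whole refl refl refl refl = flip refl refl up low U′∼U D′∼D

  R≢L : just R ≢ just L
  R≢L ()

  HeadsAgree : Word → Word → Word → Word → Set
  HeadsAgree a F G b = head (a ++ F ++ G ++ b) ≡ head (a ++ G ++ F ++ b)

  heads? : ∀ a F G b → Dec (HeadsAgree a F G b)
  heads? a F G b = Maybe.≡-dec _≟L_ (head (a ++ F ++ G ++ b)) (head (a ++ G ++ F ++ b))

  module _ (U D : Word) where

    swap-transport : ∀ a F G b → NonEmpty F → Balanced F → NonEmpty G → Balanced G → HeadsAgree a F G b →
                     Factorisation U D (a ++ F ++ G ++ b) → Factorisation U D (a ++ G ++ F ++ b)
    swap-transport a F G b nF bF nG bG agree fac with swap-factorisation a F G b nF bF nG bG fac
    ... | inside fac′ = fac′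
    ... | flip refl refl upF lowG _ _ =
          ⊥-elim (R≢L (trans (sym (upper-head upF (G ++ []))) (trans agree (lower-head lowG (F ++ [])))))

    flip-∼ : ∀ a F G b → NonEmpty F → Balanced F → NonEmpty G → Balanced G → ¬ HeadsAgree a F G b →
             Factorisation U D (a ++ F ++ G ++ b) → F ∼ U × G ∼ D
    flip-∼ a F G b nF bF nG bG disagree fac with swap-factorisation a F G b nF bF nG bG fac
    ... | inside fac′          = ⊥-elim (disagree (trans (factorisation-head fac) (sym (factorisation-head fac′))))
    ... | flip _ _ _ _ F∼U G∼D = F∼U , G∼D

    open Labelling _≟W_ (Factorisation U D)

    swapLinks : ∀ a F G b → NonEmpty F → Balanced F → NonEmpty G → Balanced G → Dec (HeadsAgree a F G b) → List Link
    swapLinks a F G b nF bF nG bG (yes agree) =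
      link (a ++ F ++ G ++ b) (a ++ G ++ F ++ b)
           (swap-transport a F G b nF bF nG bG agree) (swap-transport a G F b nG bG nF bF (sym agree)) ∷ []
    swapLinks a F G b nF bF nG bG (no _) = []

    termLinks : ∀ {t} a b → InS t → List Link
    termLinks a b (F , G , nF , bF , nG , bG , _) = swapLinks a F G b nF bF nG bG (heads? a F G b)

    links : ∀ {q} → InIdeal Sstar q → List Link
    links (none _)              = []
    links (add k a t b t∈ r∈ _) = termLinks {t} a b (S⋆⊆S t t∈) ++ links r∈

    module Count (κ : Word → Word) (respects : Respects κ) (base : Factorisation U D (U ++ D)) (lowD : Lower D) where

      f : Word → Carrier
      f w = indicator (κ w ≟W κ (U ++ D))

      tally-swap : ∀ {t} k a F G b → Sstar t → t ≃ commutator F G →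
                   (nF : NonEmpty F) (bF : Balanced F) (nG : NonEmpty G) (bG : Balanced G) →
                   (agree? : Dec (HeadsAgree a F G b)) → All (Joins κ) (swapLinks a F G b nF bF nG bG agree?) →
                   SwapWitness Sstar U D ⊎ linear f (sandwich k a t b) ≈ 0#
      tally-swap {t} k a F G b _ t≃ _ _ _ _ (yes _) (joined ∷ []) =
        inj₂ (linear-sandwich-vanishes f k a t b F G t≃ (reflexive (cong (λ v → indicator (v ≟W κ (U ++ D))) joined)))
      tally-swap {t} k a F G b t∈ t≃ nF bF nG bG (no disagree) []
        with indicator-spec (κ (a ++ F ++ G ++ b) ≟W κ (U ++ D)) | indicator-spec (κ (a ++ G ++ F ++ b) ≟W κ (U ++ D))
      ... | inj₁ (_ , fx≈1) | inj₁ (_ , fy≈1) = inj₂ (linear-sandwich-vanishes f k a t b F G t≃ (≈-trans fx≈1 (≈-sym fy≈1)))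
      ... | inj₂ (_ , fx≈0) | inj₂ (_ , fy≈0) = inj₂ (linear-sandwich-vanishes f k a t b F G t≃ (≈-trans fx≈0 (≈-sym fy≈0)))
      ... | inj₁ (x∼UD , _) | inj₂ _ =
            let F∼U , G∼D = flip-∼ a F G b nF bF nG bG disagree (respects (U ++ D) _ (sym x∼UD) base)
            in inj₁ (F , G , F∼U , G∼D , inj₁ (t , t∈ , t≃))
      ... | inj₂ _ | inj₁ (y∼UD , _) =
            let G∼U , F∼D = flip-∼ a G F b nG bG nF bF (λ agree → disagree (sym agree)) (respects (U ++ D) _ (sym y∼UD) base)
            in inj₁ (G , F , G∼U , F∼D , inj₂ (t , t∈ , t≃))

      tally-term : ∀ {t} k a b → Sstar t → (s : InS t) → All (Joins κ) (termLinks {t} a b s) →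
                   SwapWitness Sstar U D ⊎ linear f (sandwich k a t b) ≈ 0#
      tally-term {t} k a b t∈ (F , G , nF , bF , nG , bG , t≃) =
        tally-swap {t} k a F G b t∈ t≃ nF bF nG bG (heads? a F G b)

      tally : ∀ {q} (d : InIdeal Sstar q) → All (Joins κ) (links d) → SwapWitness Sstar U D ⊎ linear f q ≈ 0#
      tally {q} (none q≃0) _ = inj₂ (linear-resp-≃ f q [] q≃0)
      tally {q} (add {r = r} k a t b t∈ r∈ q≃) joined with All.++⁻ (termLinks {t} a b (S⋆⊆S t t∈)) joined
      ... | joinedₜ , joinedᵣ with tally-term k a b t∈ (S⋆⊆S t t∈) joinedₜ | tally r∈ joinedᵣ
      ...   | inj₁ w   | _        = inj₁ w
      ...   | inj₂ _   | inj₁ w   = inj₁ w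
      ...   | inj₂ t≈0 | inj₂ r≈0 = inj₂ (begin
              linear f q                                ≈⟨ linear-resp-≃ f q (sandwich k a t b ++ r) q≃ ⟩
              linear f (sandwich k a t b ++ r)          ≈⟨ linear-++ f (sandwich k a t b) r ⟩
              linear f (sandwich k a t b) + linear f r  ≈⟨ +-cong t≈0 r≈0 ⟩
              0# + 0#                                   ≈⟨ +-identityʳ 0# ⟩
              0#                                        ∎)

      commutator-UD : linear f (commutator U D) ≈ 1#
      commutator-UD = begin
        linear f (commutator U D)  ≈⟨ linear-word-⊖ f (U ++ D) (D ++ U) ⟩
        f (U ++ D) - f (D ++ U)    ≈⟨ +-cong fUD≈1 (-‿cong fDU≈0) ⟩
        1# - 0#                    ≈⟨ +-congˡ (≈-trans (≈-sym (+-identityˡ (- 0#))) (-‿inverseʳ 0#)) ⟩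
        1# + 0#                    ≈⟨ +-identityʳ 1# ⟩
        1#                         ∎
        where
        fUD≈1 : f (U ++ D) ≈ 1#
        fUD≈1 with indicator-spec (κ (U ++ D) ≟W κ (U ++ D))
        ... | inj₁ (_ , v)     = v
        ... | inj₂ (UD≁UD , _) = ⊥-elim (UD≁UD refl)
        -- DU starts with L, but every word in the class of UD starts with R
        fDU≈0 : f (D ++ U) ≈ 0#
        fDU≈0 with indicator-spec (κ (D ++ U) ≟W κ (U ++ D))
        ... | inj₂ (_ , v)     = v
        ... | inj₁ (DU∼UD , _) = ⊥-elim (R≢L (trans (sym (factorisation-head (respects (U ++ D) (D ++ U) (sym DU∼UD) base)))
                                                   (lower-head lowD U)))

    swapWitness : GeneratesJ Sstar → UpperPrime U → LowerPrime D → SwapWitness Sstar U D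
    swapWitness generates upU@((nU , bU , _) , _) lowD@((nD , bD , _) , _) =
      [ (λ w → w) , (λ vanishes → ⊥-elim (1#≉0# (≈-trans (≈-sym commutator-UD) vanishes))) ]′
        (tally derivation (label-joins (links derivation)))
      where
      derivation : InIdeal Sstar (commutator U D)
      derivation = proj₂ (generates (commutator U D)) (J-generator (U , D , nU , bU , nD , bD , λ _ → ≈-refl))
      base : Factorisation U D (U ++ D)
      base = factorisation U D refl (upperPrime⇒upper upU) (lowerPrime⇒lower lowD) ∼-refl ∼-refl
      open Count (label (links derivation)) (label-respects (links derivation)) base (lowerPrime⇒lower lowD)

proposition5p7 : {c ℓ₁ ℓ₂ p : Level} (K : HeytingField c ℓ₁ ℓ₂) →
    let open Alg K in
    (Sstar : Poly → Set p) → SubsetOfS Sstar →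
    GeneratesJ Sstar ⇔
      (∀ U D → UpperPrime U → LowerPrime D →
        ∃[ U' ] ∃[ D' ] (U' ∼ U × D' ∼ D ×
          ((commutator U' D' ∈ₚ Sstar) ⊎ (commutator D' U' ∈ₚ Sstar))))
proposition5p7 K Sstar S⋆⊆S = mk⇔
  (λ generates U D → OnlyIfDirection.swapWitness K Sstar S⋆⊆S U D generates)
  (IfDirection.if-direction K Sstar S⋆⊆S)
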